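{- Let $a\neq b$ be coprime positive integers and $A=\{a,b\}$. Let $Q(\ell)=\phi^\ell+z^\ell+\bar z^\ell$, where $\phi,z,\bar z$ are the roots of $x^3-x-1$, and define recursively $N'(\ell)=\big(Q(\ell)-\sum_{d\mid\ell,\,d<\ell}d\,N'(d)\big)/\ell$ and $N(L)=\sum_{\ell\mid L}N'(\ell)$. Then for every positive divisor $\ell$ of $a+b$ the number of distinct periodicities of $A$ of length $\ell$ is $N'(\ell)$, and the total number of distinct periodicities of $A$ is $N(a+b)$.
   Context: For a finite nonempty set $A$ of positive integers let $\alpha=\max A$. For a seed $S=s_1\cdots s_\alpha\in\{0,1\}^\alpha$, define $w^{A,S}(-\alpha-1+j)=s_j$ for $j=1,\ldots,\alpha$ and $w^{A,S}(n)=1-\min\{w^{A,S}(n-x):x\in A\}$ for $n\ge0$. $\mathcal W^A=\{(w^{A,S}(n))_{n\ge0}: S\in\{0,1\}^\alpha\}$; for $|A|\le 2$ all these sequences are purely periodic. Two such sequences $u,v$ are similar if there is $t\ge0$ with $u(n+t)=v(n)$ for all $n\ge0$ or $v(n+t)=u(n)$ for all $n\ge0$. A distinct periodicity of $A$ is an equivalence class of $\mathcal W^A$ under similarity; its length is the least period of its members. -}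

module Defs where

open import Data.Bool using (Bool; true; false; _∧_; not)
open import Data.Nat using (ℕ; zero; suc; _+_; _∸_; _<_; _≤_; _⊔_; _<?_)
open import Data.Nat.Divisibility using (_∣?_)
open import Data.Integer as ℤ using (ℤ; +_)
open import Data.Integer.DivMod using (_/ℕ_)
open import Data.Fin using (Fin; fromℕ<)
open import Data.List using (List; []; _∷_; map; filter; upTo; foldr)
open import Data.Product using (Σ; _×_; _,_)
open import Data.Sum using (_⊎_)
open import Data.Unit using (⊤)
open import Relation.Nullary using (¬_; yes; no)
open import Relation.Binary.PropositionalEquality using (_≡_; _≢_)

-- The game sequences w^{A,S} for A = {a , b}, α = max A = a ⊔ b.
-- Bits are Booleans (true = 1).  1 - min(x,y) on bits is  not (x ∧ y).

Seed : ℕ → ℕ → Set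
Seed a b = Fin (a ⊔ b) → Bool

-- v k = w^{A,S}(k - α), k ≥ 0 (so k < α is the seed region:
-- v k = s_{k+1}).  Computed with fuel (fuel k+1 suffices since a,b ≥ 1).
vFuel : (a b : ℕ) → Seed a b → ℕ → ℕ → Bool
vFuel a b s zero k = false
vFuel a b s (suc f) k with k <? (a ⊔ b)
... | yes k<α = s (fromℕ< k<α)
... | no _ = not (vFuel a b s f (k ∸ a) ∧ vFuel a b s f (k ∸ b))

w : (a b : ℕ) → Seed a b → ℕ → Bool
w a b s n = vFuel a b s (suc (n + (a ⊔ b))) (n + (a ⊔ b))

Similar : (ℕ → Bool) → (ℕ → Bool) → Set
Similar u v =
  Σ ℕ (λ t → (∀ n → u (n + t) ≡ v n) ⊎ (∀ n → v (n + t) ≡ u n))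

IsPeriod : (ℕ → Bool) → ℕ → Set
IsPeriod u p = 1 ≤ p × (∀ n → u (n + p) ≡ u n)

IsLeastPeriod : (ℕ → Bool) → ℕ → Set
IsLeastPeriod u p = IsPeriod u p × (∀ q → IsPeriod u q → p ≤ q)

-- Counting distinct periodicities (similarity classes of W^A).
-- "The number of classes whose members satisfy P is n": there are n
-- pairwise non-similar seeds R 0 … R (n-1), all satisfying P, and every
-- seed whose sequence satisfies P is similar to one of them.

NumClasses : (a b : ℕ) → ((ℕ → Bool) → Set) → ℕ → Set
NumClasses a b P n =
  Σ (Fin n → Seed a b) λ R →
      (∀ i → P (w a b (R i)))
    × (∀ i j → Similar (w a b (R i)) (w a b (R j)) → i ≡ j)
    × (∀ (s : Seed a b) → P (w a b s) →
         Σ (Fin n) λ i → Similar (w a b s) (w a b (R i)))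

NumPeriodicitiesOfLength : (a b ℓ n : ℕ) → Set
NumPeriodicitiesOfLength a b ℓ n = NumClasses a b (λ u → IsLeastPeriod u ℓ) n

NumPeriodicities : (a b n : ℕ) → Set
NumPeriodicities a b n = NumClasses a b (λ _ → ⊤) n

-- Q(ℓ) = φ^ℓ + z^ℓ + z̄^ℓ, the power sums of the roots of x³ - x - 1.
-- By Newton's identities (e1 = 0, e2 = -1, e3 = 1): Q 0 = 3, Q 1 = 0,
-- Q 2 = 2, Q (n+3) = Q (n+1) + Q n  (the Perrin numbers).

Q : ℕ → ℤ
Q 0 = + 3
Q 1 = + 0
Q 2 = + 2
Q (suc (suc (suc n))) = Q (suc n) ℤ.+ Q n

sumℤ : List ℤ → ℤ
sumℤ = foldr ℤ._+_ (+ 0)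

properDivisors : ℕ → List ℕ
properDivisors ℓ = filter (λ d → d ∣? ℓ) (map suc (upTo (ℓ ∸ 1)))

divisors : ℕ → List ℕ
divisors L = filter (λ d → d ∣? L) (map suc (upTo L))

N'Fuel : ℕ → ℕ → ℤ
N'Fuel zero ℓ = + 0
N'Fuel (suc f) zero = + 0
N'Fuel (suc f) (suc m) =
  (Q (suc m) ℤ.- sumℤ (map (λ d → + d ℤ.* N'Fuel f d) (properDivisors (suc m))))
    /ℕ suc m

N' : ℕ → ℤ
N' ℓ = N'Fuel ℓ ℓ

N : ℕ → ℤ
N L = sumℤ (map N' (divisors L))

{-# OPTIONS --safe #-}
-- A game sequence satisfies w (n + a + b) = not (w (n + b) ∧ w (n + a)). From index α on it is
-- (a + b)-periodic: a 0 forces 1s a and b places later and hence a 0 again a + b later, while a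
-- 1 is caused by an earlier 0. So every game sequence is similar to an (a + b)-periodic solution
-- of the rule, and every periodic solution is the game sequence of the seed formed by α of its
-- consecutive values.
--
-- For ℓ ∣ a + b we have b ≡ −a (mod ℓ), and a is a unit modulo ℓ. Reading an ℓ-periodic solution
-- along 0, a, 2a, … is therefore a bijection onto the ℓ-periodic words in which a bit is 0 exactly
-- when both of its neighbours are 1, i.e. onto the closed walks of length ℓ in a transfer graph on
-- pairs of bits; there are Q ℓ of them. Sorting the ℓ-periodic solutions into shift orbits gives
-- Σ_{d ∣ ℓ} d · (number of orbits of least period d) = Q ℓ, which is the recursion defining N'.
module Submission where

open import Defs
open import Data.Nat using (ℕ; _+_; _≤_)
open import Data.Nat.Divisibility using (_∣_)
open import Data.Nat.GCD using (gcd)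
open import Data.Integer using (+_)
open import Data.Product using (Σ; _×_)
open import Relation.Binary.PropositionalEquality using (_≡_; _≢_)

open import Data.Bool using (Bool; true; false; not; _∧_)
open import Data.Bool.Properties using (∧-comm)
import Data.Bool as Bool
open import Data.Fin as Fin using (Fin; toℕ)
import Data.Fin.Properties as Fin
import Data.Integer as ℤ
import Data.Integer.Properties as ℤ
open import Data.List using (List; []; _∷_; _++_; map; length; lookup; concatMap; filter; upTo)
open import Data.List.Properties
  using (length-++; length-map; length-upTo; map-cong; upTo-∷ʳ; map-++; filter-++; filter-accept)
open import Data.List.Relation.Unary.All as All using (All)
import Data.List.Relation.Unary.All.Properties as All
open import Data.List.Relation.Unary.Any as Any using (Any; here; there)
import Data.List.Relation.Unary.Any.Properties as Any
open import Data.List.Relation.Unary.AllPairs as AllPairs using (AllPairs)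
import Data.List.Relation.Unary.AllPairs.Properties as AllPairs
import Data.List.Relation.Unary.Unique.Propositional.Properties as Unique
open import Data.List.Membership.Propositional using (_∈_)
open import Data.List.Membership.Propositional.Properties
  using (∈-lookup; ∈-filter⁺; ∈-filter⁻; ∈-map⁺; ∈-map⁻; ∈-upTo⁺; ∈-upTo⁻)
open import Data.Nat
open import Data.Nat.Coprimality using (Coprime; coprime⇒gcd≡1; gcd≡1⇒coprime)
open import Data.Nat.DivMod
open import Data.Nat.Divisibility using (divides; _∣?_; ∣-refl; ∣-trans; ∣⇒≤; ∣m+n∣m⇒∣n; m%n≡0⇒n∣m)
open import Data.Nat.GCD using (gcd-GCD; module Bézout)
open import Data.Nat.Induction using (<-rec)
open import Data.Nat.ListAction using (sum)
open import Data.Nat.ListAction.Properties using (sum-++)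
open import Data.Nat.Properties
open import Algebra.Properties.CommutativeSemigroup +-commutativeSemigroup
  using (xy∙z≈xz∙y; x∙yz≈xz∙y; x∙yz≈y∙xz; x∙yz≈z∙xy; interchange)
open import Data.Nat.Tactic.RingSolver using (solve)
open import Data.Product using (∃₂; ∃-syntax; _,_; proj₁; proj₂)
open import Data.Sum using (_⊎_; inj₁; inj₂)
import Data.Sum as Sum
open import Data.Unit using (tt)
open import Function using (_∘_; it)
open import Relation.Binary.Definitions using (Symmetric; Transitive; Decidable; tri<; tri≈; tri>)
open import Relation.Binary.PropositionalEquality
open import Relation.Nullary using (¬_; Dec; yes; no; contradiction)
open import Relation.Nullary.Decidable using (_×-dec_; ¬?)
open ≡-Reasoning

module _ {A : Set} where

  open All.All
  open AllPairs.AllPairs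

  nubBy : {R : A → A → Set} → Decidable R → List A → List A
  nubBy R? []       = []
  nubBy R? (x ∷ xs) with Any.any? (R? x) (nubBy R? xs)
  ... | yes _ = nubBy R? xs
  ... | no  _ = x ∷ nubBy R? xs

  module _ {R : A → A → Set} (R? : Decidable R) where

    nubBy⁺ : ∀ {P : A → Set} {xs} → All P xs → All P (nubBy R? xs)
    nubBy⁺ {xs = []}     []         = []
    nubBy⁺ {xs = x ∷ xs} (px ∷ pxs) with Any.any? (R? x) (nubBy R? xs)
    ... | yes _ = nubBy⁺ pxs
    ... | no  _ = px ∷ nubBy⁺ pxs

    nubBy-unrelated : ∀ xs → AllPairs (λ x y → ¬ R x y) (nubBy R? xs)
    nubBy-unrelated []       = []
    nubBy-unrelated (x ∷ xs) with Any.any? (R? x) (nubBy R? xs)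
    ... | yes _    = nubBy-unrelated xs
    ... | no  ¬any = All.¬Any⇒All¬ _ ¬any ∷ nubBy-unrelated xs

    -- Unlike for deduplicate, no transitivity is needed: a dropped element is related to a kept one.
    nubBy-covers : ∀ {P : A → Set} → (∀ {x} → P x → R x x) →
                   ∀ {xs} → All P xs → All (λ x → Any (R x) (nubBy R? xs)) xs
    nubBy-covers refl′ {[]}     []         = []
    nubBy-covers refl′ {x ∷ xs} (px ∷ pxs) with Any.any? (R? x) (nubBy R? xs)
    ... | yes related = related ∷ nubBy-covers refl′ pxs
    ... | no  _       = here (refl′ px) ∷ All.map there (nubBy-covers refl′ pxs)

  allPairs-lookup-injective : ∀ {S : A → A → Set} → Symmetric S → ∀ {xs} →
    AllPairs (λ x y → ¬ S x y) xs → ∀ i j → S (lookup xs i) (lookup xs j) → i ≡ j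
  allPairs-lookup-injective sym′ (_ ∷ _)   Fin.zero    Fin.zero    _ = refl
  allPairs-lookup-injective sym′ (¬S ∷ _)  Fin.zero    (Fin.suc j) s =
    contradiction s (All.lookup ¬S (∈-lookup j))
  allPairs-lookup-injective sym′ (¬S ∷ _)  (Fin.suc i) Fin.zero    s =
    contradiction (sym′ s) (All.lookup ¬S (∈-lookup i))
  allPairs-lookup-injective sym′ (_ ∷ ¬Ss) (Fin.suc i) (Fin.suc j) s =
    cong Fin.suc (allPairs-lookup-injective sym′ ¬Ss i j s)

  allPairs-mapWith : ∀ {P : A → Set} {R S : A → A → Set} → (∀ {x y} → P x → P y → R x y → S x y) →
                     ∀ {xs} → All P xs → AllPairs R xs → AllPairs S xs
  allPairs-mapWith f []         []         = []
  allPairs-mapWith f (px ∷ pxs) (rx ∷ rxs) =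
    All.zipWith (λ (py , rxy) → f px py rxy) (pxs , rx) ∷ allPairs-mapWith f pxs rxs

  any-mapWith : ∀ {P Q R : A → Set} → (∀ {x} → P x → Q x → R x) → ∀ {xs} → All P xs → Any Q xs → Any R xs
  any-mapWith f (px ∷ _)   (here qx) = here (f px qx)
  any-mapWith f (_  ∷ pxs) (there q) = there (any-mapWith f pxs q)

  sum-map-const : ∀ k (xs : List A) → sum (map (λ _ → k) xs) ≡ k * length xs
  sum-map-const k []       = sym (*-zeroʳ k)
  sum-map-const k (x ∷ xs) = trans (cong (_+_ k) (sum-map-const k xs)) (sym (*-suc k (length xs)))

  sum-map-+ : ∀ (f g : A → ℕ) xs → sum (map (λ x → f x + g x) xs) ≡ sum (map f xs) + sum (map g xs)
  sum-map-+ f g []       = refl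
  sum-map-+ f g (x ∷ xs) =
    trans (cong (_+_ (f x + g x)) (sum-map-+ f g xs)) (interchange (f x) (g x) _ _)

  record Enumerates (R : A → A → Set) (P : A → Set) (xs : List A) : Set where
    field
      sound    : All P xs
      distinct : AllPairs (λ x y → ¬ R x y) xs
      complete : ∀ {u} → P u → Any (R u) xs

  enumerates-length-≤ : ∀ {R : A → A → Set} {P xs ys} → Symmetric R → Transitive R →
                        Enumerates R P xs → Enumerates R P ys → length xs ≤ length ys
  enumerates-length-≤ {R} {xs = xs} {ys} sym′ trans′ ex ey = Fin.injective⇒≤ injective
    where
    module X = Enumerates ex
    module Y = Enumerates ey
    hit : ∀ i → Any (R (lookup xs i)) ys
    hit i = Y.complete (All.lookup X.sound (∈-lookup i))
    injective : ∀ {i j} → Any.index (hit i) ≡ Any.index (hit j) → i ≡ j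
    injective {i} {j} eq = allPairs-lookup-injective sym′ X.distinct i j
      (trans′ (Any.lookup-index (hit i))
              (sym′ (subst (λ k → R (lookup xs j) (lookup ys k)) (sym eq) (Any.lookup-index (hit j)))))

  enumerates-length : ∀ {R : A → A → Set} {P xs ys} → Symmetric R → Transitive R →
                      Enumerates R P xs → Enumerates R P ys → length xs ≡ length ys
  enumerates-length sym′ trans′ ex ey =
    ≤-antisym (enumerates-length-≤ sym′ trans′ ex ey) (enumerates-length-≤ sym′ trans′ ey ex)

module _ {A B : Set} where

  open All.All
  open AllPairs.AllPairs

  length-concatMap : ∀ (f : B → List A) xs → length (concatMap f xs) ≡ sum (map (length ∘ f) xs)
  length-concatMap f []       = refl
  length-concatMap f (x ∷ xs) =
    trans (length-++ (f x)) (cong (_+_ (length (f x))) (length-concatMap f xs))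

  concatMap-all⁺ : ∀ {P : A → Set} (f : B → List A) {xs} → All (All P ∘ f) xs → All P (concatMap f xs)
  concatMap-all⁺ f = All.concat⁺ ∘ All.map⁺

  concatMap-allPairs⁺ : ∀ {R : A → A → Set} {D : B → B → Set} {Q : B → A → Set} {f : B → List A} {ds} →
    AllPairs D ds → All (λ d → AllPairs R (f d)) ds → All (λ d → All (Q d) (f d)) ds →
    (∀ {d d′ x y} → D d d′ → Q d x → Q d′ y → R x y) → AllPairs R (concatMap f ds)
  concatMap-allPairs⁺ []         []         []         _     = []
  concatMap-allPairs⁺ (Dd ∷ Dds) (Rd ∷ Rds) (Qd ∷ Qds) cross =
    AllPairs.++⁺ Rd (concatMap-allPairs⁺ Dds Rds Qds cross) (All.map (λ Qx →
      All.concat⁺ (All.map⁺ (All.zipWith (λ (D′ , Q′) → All.map (cross D′ Qx) Q′) (Dd , Qds)))) Qd)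

Seq : Set
Seq = ℕ → Bool

Periodic : ℕ → Seq → Set
Periodic ℓ u = ∀ n → u (n + ℓ) ≡ u n

shift : ℕ → Seq → Seq
shift t u n = u (n + t)

AgreeBelow : ℕ → Seq → Seq → Set
AgreeBelow ℓ u v = ∀ {i} → i < ℓ → u i ≡ v i

agreeBelow? : ∀ ℓ u v → Dec (AgreeBelow ℓ u v)
agreeBelow? ℓ u v = allUpTo? (λ i → u i Bool.≟ v i) ℓ

periodic-resp : ∀ {ℓ u v} → u ≗ v → Periodic ℓ u → Periodic ℓ v
periodic-resp {ℓ} {u} {v} u≗v p n = begin
  v (n + ℓ) ≡⟨ u≗v (n + ℓ) ⟨
  u (n + ℓ) ≡⟨ p n ⟩
  u n       ≡⟨ u≗v n ⟩
  v n       ∎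

periodic-+* : ∀ {ℓ u} → Periodic ℓ u → ∀ n k → u (n + k * ℓ) ≡ u n
periodic-+* {ℓ} {u} p n zero    = cong u (+-identityʳ n)
periodic-+* {ℓ} {u} p n (suc k) = begin
  u (n + (ℓ + k * ℓ)) ≡⟨ cong u (x∙yz≈xz∙y n ℓ (k * ℓ)) ⟩
  u (n + k * ℓ + ℓ)   ≡⟨ p (n + k * ℓ) ⟩
  u (n + k * ℓ)       ≡⟨ periodic-+* p n k ⟩
  u n                 ∎

periodic-≡ : ∀ {ℓ u m n} i j → Periodic ℓ u → m + i * ℓ ≡ n + j * ℓ → u m ≡ u n
periodic-≡ {ℓ} {u} {m} {n} i j p eq = begin
  u m           ≡⟨ periodic-+* p m i ⟨
  u (m + i * ℓ) ≡⟨ cong u eq ⟩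
  u (n + j * ℓ) ≡⟨ periodic-+* p n j ⟩
  u n           ∎

periodic-% : ∀ {ℓ u} .{{_ : NonZero ℓ}} → Periodic ℓ u → ∀ x n → u (x + n) ≡ u (x + n % ℓ)
periodic-% {ℓ} p x n = periodic-≡ 0 (n / ℓ) p (begin
  x + n + 0                 ≡⟨ +-identityʳ (x + n) ⟩
  x + n                     ≡⟨ cong (_+_ x) (m≡m%n+[m/n]*n n ℓ) ⟩
  x + (n % ℓ + n / ℓ * ℓ)   ≡⟨ +-assoc x (n % ℓ) _ ⟨
  x + n % ℓ + n / ℓ * ℓ     ∎)

periodic-∣ : ∀ {d ℓ u} → d ∣ ℓ → Periodic d u → Periodic ℓ u
periodic-∣ (divides k refl) p n = periodic-+* p n k

shift-periodic : ∀ {ℓ u} t → Periodic ℓ u → Periodic ℓ (shift t u)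
shift-periodic {ℓ} {u} t p n = trans (cong u (xy∙z≈xz∙y n ℓ t)) (p (n + t))

periodic-ext : ∀ {ℓ u v} .{{_ : NonZero ℓ}} → Periodic ℓ u → Periodic ℓ v → AgreeBelow ℓ u v → u ≗ v
periodic-ext {ℓ} {u} {v} pu pv agree n = begin
  u n       ≡⟨ periodic-% pu 0 n ⟩
  u (n % ℓ) ≡⟨ agree (m%n<n n ℓ) ⟩
  v (n % ℓ) ≡⟨ periodic-% pv 0 n ⟨
  v n       ∎

periodic-fromBlock : ∀ {ℓ q u} .{{_ : NonZero ℓ}} → Periodic ℓ u → AgreeBelow ℓ (shift q u) u → Periodic q u
periodic-fromBlock {q = q} p agree = periodic-ext (shift-periodic q p) p agree

periodic-unshift : ∀ {d e i u} → Periodic d u → i ≤ d → Periodic e (shift i u) → Periodic e u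
periodic-unshift {d} {e} {i} {u} p i≤d pe = periodic-resp back (shift-periodic (d ∸ i) pe)
  where
  back : shift (d ∸ i) (shift i u) ≗ u
  back n = trans (cong u (trans (+-assoc n (d ∸ i) i) (cong (_+_ n) (m∸n+n≡m i≤d)))) (p n)

leastPeriod-resp : ∀ {d u v} → u ≗ v → IsLeastPeriod u d → IsLeastPeriod v d
leastPeriod-resp u≗v ((d≥1 , p) , least) =
  (d≥1 , periodic-resp u≗v p) , λ q (q≥1 , pq) → least q (q≥1 , periodic-resp (sym ∘ u≗v) pq)

leastPeriod-unique : ∀ {d e u} → IsLeastPeriod u d → IsLeastPeriod u e → d ≡ e
leastPeriod-unique (pd , least-d) (pe , least-e) = ≤-antisym (least-d _ pe) (least-e _ pd)

HasSmallerPeriod : ℕ → Seq → Set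
HasSmallerPeriod ℓ u = ∃[ q ] q < ℓ × 1 ≤ q × AgreeBelow ℓ (shift q u) u

hasSmallerPeriod? : ∀ ℓ u → Dec (HasSmallerPeriod ℓ u)
hasSmallerPeriod? ℓ u = anyUpTo? (λ q → 1 ≤? q ×-dec agreeBelow? ℓ (shift q u) u) ℓ

leastPeriod⇒¬hasSmallerPeriod : ∀ {ℓ u} → IsLeastPeriod u ℓ → ¬ HasSmallerPeriod ℓ u
leastPeriod⇒¬hasSmallerPeriod {ℓ} ((ℓ≥1 , p) , least) (q , q<ℓ , q≥1 , agree) =
  <⇒≱ q<ℓ (least q (q≥1 , periodic-fromBlock p agree))
  where
  instance
    ℓ≢0 : NonZero ℓ
    ℓ≢0 = >-nonZero ℓ≥1

¬hasSmallerPeriod⇒leastPeriod : ∀ {ℓ u} → IsPeriod u ℓ → ¬ HasSmallerPeriod ℓ u → IsLeastPeriod u ℓ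
¬hasSmallerPeriod⇒leastPeriod pℓ none = pℓ , λ q (q≥1 , pq) →
  ≮⇒≥ λ q<ℓ → none (q , q<ℓ , q≥1 , λ {i} _ → pq i)

leastPeriod-exists : ∀ {u} ℓ → IsPeriod u ℓ → ∃[ d ] IsLeastPeriod u d
leastPeriod-exists {u} = <-rec (λ ℓ → IsPeriod u ℓ → ∃[ d ] IsLeastPeriod u d) search
  where
  search : ∀ ℓ → (∀ {q} → q < ℓ → IsPeriod u q → ∃[ d ] IsLeastPeriod u d) →
           IsPeriod u ℓ → ∃[ d ] IsLeastPeriod u d
  search ℓ smaller pℓ@(ℓ≥1 , p) with hasSmallerPeriod? ℓ u
  ... | yes (q , q<ℓ , q≥1 , agree) = smaller q<ℓ (q≥1 , periodic-fromBlock p agree)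
    where
    instance
      ℓ≢0 : NonZero ℓ
      ℓ≢0 = >-nonZero ℓ≥1
  ... | no none = ℓ , ¬hasSmallerPeriod⇒leastPeriod pℓ none

leastPeriod-∣ : ∀ {d ℓ u} → IsLeastPeriod u d → Periodic ℓ u → d ∣ ℓ
leastPeriod-∣ {d} {ℓ} {u} ((d≥1 , pd) , least) pℓ = m%n≡0⇒n∣m ℓ d remainder≡0
  where
  instance
    d≢0 : NonZero d
    d≢0 = >-nonZero d≥1
  remainder-periodic : Periodic (ℓ % d) u
  remainder-periodic n = begin
    u (n + ℓ % d)             ≡⟨ periodic-+* pd (n + ℓ % d) (ℓ / d) ⟨
    u (n + ℓ % d + ℓ / d * d) ≡⟨ cong u (trans (+-assoc n _ _) (cong (_+_ n) (sym (m≡m%n+[m/n]*n ℓ d)))) ⟩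
    u (n + ℓ)                 ≡⟨ pℓ n ⟩
    u n                       ∎
  remainder≡0 : ℓ % d ≡ 0
  remainder≡0 with ℓ % d in eq
  ... | zero  = refl
  ... | suc r = contradiction
    (least (suc r) (s≤s z≤n , subst (λ q → Periodic q u) eq remainder-periodic))
    (<⇒≱ (subst (_< d) eq (m%n<n ℓ d)))

record Shifts (u v : Seq) : Set where
  constructor shiftBy
  field
    offset  : ℕ
    shifted : shift offset u ≗ v

shifts-trans : ∀ {u v w} → Shifts u v → Shifts v w → Shifts u w
shifts-trans {u} {v} {w} (shiftBy t u→v) (shiftBy s v→w) = shiftBy (s + t) λ n → begin
  u (n + (s + t)) ≡⟨ cong u (+-assoc n s t) ⟨
  u (n + s + t)   ≡⟨ u→v (n + s) ⟩
  v (n + s)       ≡⟨ v→w n ⟩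
  w n             ∎

≗⇒shifts : ∀ {u v} → u ≗ v → Shifts u v
≗⇒shifts {u} u≗v = shiftBy 0 λ n → trans (cong u (+-identityʳ n)) (u≗v n)

shifts-unshift : ∀ {t u v} → Shifts (shift t u) v → Shifts u v
shifts-unshift {t} {u} (shiftBy s h) = shiftBy (s + t) λ n → trans (cong u (sym (+-assoc n s t))) (h n)

shifts-sym : ∀ {d u v} .{{_ : NonZero d}} → Periodic d u → Shifts u v → Shifts v u
shifts-sym {suc k} {u} {v} p (shiftBy t u→v) = shiftBy (t * k) λ n → begin
  v (n + t * k)         ≡⟨ u→v (n + t * k) ⟨
  u (n + t * k + t)     ≡⟨ cong u (solve (n ∷ t ∷ k ∷ [])) ⟩
  u (n + t * suc k)     ≡⟨ periodic-+* p n t ⟩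
  u n                   ∎

shifts-periodic : ∀ {q u v} → Shifts u v → Periodic q u → Periodic q v
shifts-periodic (shiftBy t u→v) p = periodic-resp u→v (shift-periodic t p)

shift-% : ∀ {d u} .{{_ : NonZero d}} → Periodic d u → ∀ t → shift t u ≗ shift (t % d) u
shift-% p t n = periodic-% p n t

shifts⇒similar : ∀ {u v} → Shifts u v → Similar u v
shifts⇒similar (shiftBy t u→v) = t , inj₁ u→v

similar⇒shifts : ∀ {d e u v} .{{_ : NonZero d}} .{{_ : NonZero e}} →
                 Periodic d u → Periodic e v → Similar u v → Shifts u v × Shifts v u
similar⇒shifts pu pv (t , inj₁ u→v) = shiftBy t u→v , shifts-sym pu (shiftBy t u→v)
similar⇒shifts pu pv (t , inj₂ v→u) = shifts-sym pv (shiftBy t v→u) , shiftBy t v→u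

similar-sym : ∀ {u v} → Similar u v → Similar v u
similar-sym (t , inj₁ h) = t , inj₂ h
similar-sym (t , inj₂ h) = t , inj₁ h

similar-resp : ∀ {u u′ v v′} → u ≗ u′ → v ≗ v′ → Similar u v → Similar u′ v′
similar-resp u≗u′ v≗v′ (t , inj₁ h) = t , inj₁ λ n → trans (sym (u≗u′ _)) (trans (h n) (v≗v′ n))
similar-resp u≗u′ v≗v′ (t , inj₂ h) = t , inj₂ λ n → trans (sym (v≗v′ _)) (trans (h n) (u≗u′ n))

similar-leastPeriod : ∀ {d e u v} → IsLeastPeriod u d → IsLeastPeriod v e → Similar u v → d ≡ e
similar-leastPeriod {d} {e} {u} {v} ((d≥1 , pu) , least-u) ((e≥1 , pv) , least-v) sim =
  ≤-antisym (least-u e (e≥1 , shifts-periodic v→u pv)) (least-v d (d≥1 , shifts-periodic u→v pu))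
  where
  instance
    d≢0 : NonZero d
    d≢0 = >-nonZero d≥1
    e≢0 : NonZero e
    e≢0 = >-nonZero e≥1
  u→v : Shifts u v
  u→v = proj₁ (similar⇒shifts pu pv sim)
  v→u : Shifts v u
  v→u = proj₂ (similar⇒shifts pu pv sim)

shift-leastPeriod : ∀ {d u} t → IsLeastPeriod u d → IsLeastPeriod (shift t u) d
shift-leastPeriod {d} {u} t ((d≥1 , p) , least) =
  (d≥1 , shift-periodic t p) , λ q (q≥1 , pq) → least q (q≥1 , shifts-periodic back pq)
  where
  instance
    d≢0 : NonZero d
    d≢0 = >-nonZero d≥1
  back : Shifts (shift t u) u
  back = shifts-sym p (shiftBy t λ _ → refl)

shift-distinct : ∀ {d i j u} → IsLeastPeriod u d → i < j → j < d → ¬ shift i u ≗ shift j u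
shift-distinct {d} {i} {j} {u} ((_ , p) , least) i<j j<d eq =
  <⇒≱ (≤-<-trans (m∸n≤m j i) j<d)
      (least (j ∸ i) (m<n⇒0<n∸m i<j , periodic-unshift p (<⇒≤ (<-trans i<j j<d)) shifted))
  where
  shifted : Periodic (j ∸ i) (shift i u)
  shifted n = begin
    u (n + (j ∸ i) + i) ≡⟨ cong u (trans (+-assoc n _ i) (cong (_+_ n) (m∸n+n≡m (<⇒≤ i<j)))) ⟩
    u (n + j)           ≡⟨ eq n ⟨
    u (n + i)           ∎

shift-injective : ∀ {d i j u} → IsLeastPeriod u d → i < d → j < d → shift i u ≗ shift j u → i ≡ j
shift-injective lp i<d j<d eq with <-cmp _ _
... | tri< i<j _ _ = contradiction eq (shift-distinct lp i<j j<d)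
... | tri≈ _ i≡j _ = i≡j
... | tri> _ _ j<i = contradiction (sym ∘ eq) (shift-distinct lp j<i i<d)

Rotates : ℕ → Seq → Seq → Set
Rotates d u v = ∃[ t ] t < d × AgreeBelow d (shift t u) v

rotates? : ∀ d u v → Dec (Rotates d u v)
rotates? d u v = anyUpTo? (λ t → agreeBelow? d (shift t u) v) d

rotates-refl : ∀ {d u} .{{_ : NonZero d}} → Rotates d u u
rotates-refl {d} {u} = 0 , >-nonZero⁻¹ d , λ {i} _ → cong u (+-identityʳ i)

rotates⇒similar : ∀ {d u v} .{{_ : NonZero d}} → Periodic d u → Periodic d v → Rotates d u v → Similar u v
rotates⇒similar pu pv (t , _ , agree) = t , inj₁ (periodic-ext (shift-periodic t pu) pv agree)

similar⇒rotates : ∀ {d u v} .{{_ : NonZero d}} → Periodic d u → Periodic d v → Similar u v → Rotates d u v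
similar⇒rotates {d} pu pv sim with proj₁ (similar⇒shifts pu pv sim)
... | shiftBy t u→v = t % d , m%n<n t d , λ {i} _ → trans (sym (shift-% pu t i)) (u→v i)

-- The game

GameRule : ℕ → ℕ → Seq → Set
GameRule a b u = ∀ n → u (n + (a + b)) ≡ not (u (n + b) ∧ u (n + a))

-- The form GameRule takes on (a + b)-periodic sequences, where n − a ≡ n + b and n − b ≡ n + a.
CyclicGameRule : ℕ → ℕ → Seq → Set
CyclicGameRule a b u = ∀ n → u n ≡ not (u (n + a) ∧ u (n + b))

shift-gameRule : ∀ {a b u} t → GameRule a b u → GameRule a b (shift t u)
shift-gameRule {a} {b} {u} t rule n = begin
  u (n + (a + b) + t)                 ≡⟨ cong u (xy∙z≈xz∙y n (a + b) t) ⟩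
  u (n + t + (a + b))                 ≡⟨ rule (n + t) ⟩
  not (u (n + t + b) ∧ u (n + t + a)) ≡⟨ cong₂ (λ x y → not (u x ∧ u y)) (xy∙z≈xz∙y n t b)
                                                                         (xy∙z≈xz∙y n t a) ⟩
  not (u (n + b + t) ∧ u (n + a + t)) ∎

shift-cyclicGameRule : ∀ {a b u} t → CyclicGameRule a b u → CyclicGameRule a b (shift t u)
shift-cyclicGameRule {a} {b} {u} t rule n = begin
  u (n + t)                           ≡⟨ rule (n + t) ⟩
  not (u (n + t + a) ∧ u (n + t + b)) ≡⟨ cong₂ (λ x y → not (u x ∧ u y)) (xy∙z≈xz∙y n t a)
                                                                         (xy∙z≈xz∙y n t b) ⟩
  not (u (n + a + t) ∧ u (n + b + t)) ∎

gameRule⇒cyclicGameRule : ∀ {a b u} → Periodic (a + b) u → GameRule a b u → CyclicGameRule a b u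
gameRule⇒cyclicGameRule {a} {b} {u} p rule n = begin
  u n                             ≡⟨ p n ⟨
  u (n + (a + b))                 ≡⟨ rule n ⟩
  not (u (n + b) ∧ u (n + a))     ≡⟨ cong not (∧-comm (u (n + b)) (u (n + a))) ⟩
  not (u (n + a) ∧ u (n + b))     ∎

cyclicGameRule⇒gameRule : ∀ {a b u} → Periodic (a + b) u → CyclicGameRule a b u → GameRule a b u
cyclicGameRule⇒gameRule {a} {b} {u} p rule n = begin
  u (n + (a + b))                 ≡⟨ p n ⟩
  u n                             ≡⟨ rule n ⟩
  not (u (n + a) ∧ u (n + b))     ≡⟨ cong not (∧-comm (u (n + a)) (u (n + b))) ⟩
  not (u (n + b) ∧ u (n + a))     ∎

not-∧≡true : ∀ {x y} → x ≡ false ⊎ y ≡ false → not (x ∧ y) ≡ true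
not-∧≡true {false} _           = refl
not-∧≡true {true}  (inj₂ refl) = refl

not-∧≡true⁻¹ : ∀ {x y} → not (x ∧ y) ≡ true → x ≡ false ⊎ y ≡ false
not-∧≡true⁻¹ {false}         _ = inj₁ refl
not-∧≡true⁻¹ {true}  {false} _ = inj₂ refl

n≡m+o⇒n∸m≡o : ∀ {n} m o → n ≡ m + o → n ∸ m ≡ o
n≡m+o⇒n∸m≡o m o refl = m+n∸m≡n m o

module Game (a b : ℕ) (a≥1 : 1 ≤ a) (b≥1 : 1 ≤ b) where

  α : ℕ
  α = a ⊔ b

  a≤α : a ≤ α
  a≤α = m≤m⊔n a b

  b≤α : b ≤ α
  b≤α = m≤n⊔m a b

  ∸-< : ∀ {x k} → 1 ≤ x → x ≤ α → α ≤ k → k ∸ x < k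
  ∸-< x≥1 x≤α α≤k = ∸-monoʳ-< x≥1 (≤-trans x≤α α≤k)

  α+α≤⇒α≤ : ∀ {k} → α + α ≤ k → α ≤ k
  α+α≤⇒α≤ = ≤-trans (m≤m+n α α)

  α+α≤⇒α≤∸ : ∀ {x k} → x ≤ α → α + α ≤ k → α ≤ k ∸ x
  α+α≤⇒α≤∸ {x} {k} x≤α 2α≤k =
    ≤-trans (m≤m+n α (α ∸ x)) (subst (_≤ k ∸ x) (+-∸-assoc α x≤α) (∸-monoˡ-≤ x 2α≤k))

  -- value k is w (k − α): indices are shifted by α so that the seed occupies 0 … α − 1.
  module Run (s : Seed a b) where

    value : ℕ → Bool
    value k = vFuel a b s (suc k) k

    vFuel-fuel-irrelevant : ∀ f f′ k → k < f → k < f′ → vFuel a b s f k ≡ vFuel a b s f′ k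
    vFuel-fuel-irrelevant (suc f) (suc f′) k (s≤s k≤f) (s≤s k≤f′) with k <? (a ⊔ b)
    ... | yes _  = refl
    ... | no k≮α = cong₂ (λ x y → not (x ∧ y))
      (vFuel-fuel-irrelevant f f′ (k ∸ a) (<-≤-trans k∸a<k k≤f) (<-≤-trans k∸a<k k≤f′))
      (vFuel-fuel-irrelevant f f′ (k ∸ b) (<-≤-trans k∸b<k k≤f) (<-≤-trans k∸b<k k≤f′))
      where
      k∸a<k : k ∸ a < k
      k∸a<k = ∸-< a≥1 a≤α (≮⇒≥ k≮α)
      k∸b<k : k ∸ b < k
      k∸b<k = ∸-< b≥1 b≤α (≮⇒≥ k≮α)

    value-rule : ∀ {k} → α ≤ k → value k ≡ not (value (k ∸ a) ∧ value (k ∸ b))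
    value-rule {k} α≤k with k <? (a ⊔ b)
    ... | yes k<α = contradiction α≤k (<⇒≱ k<α)
    ... | no _    = cong₂ (λ x y → not (x ∧ y))
      (vFuel-fuel-irrelevant k (suc (k ∸ a)) (k ∸ a) (∸-< a≥1 a≤α α≤k) ≤-refl)
      (vFuel-fuel-irrelevant k (suc (k ∸ b)) (k ∸ b) (∸-< b≥1 b≤α α≤k) ≤-refl)

    value-true : ∀ {k} → α ≤ k → value (k ∸ a) ≡ false ⊎ value (k ∸ b) ≡ false → value k ≡ true
    value-true α≤k some-false = trans (value-rule α≤k) (not-∧≡true some-false)

    value-true⁻¹ : ∀ {k} → α ≤ k → value k ≡ true → value (k ∸ a) ≡ false ⊎ value (k ∸ b) ≡ false
    value-true⁻¹ α≤k vk = not-∧≡true⁻¹ (trans (sym (value-rule α≤k)) vk)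

    value-false : ∀ {k} → α ≤ k → value (k ∸ a) ≡ true → value (k ∸ b) ≡ true → value k ≡ false
    value-false α≤k va vb = trans (value-rule α≤k) (cong₂ (λ x y → not (x ∧ y)) va vb)

    value-gameRule : ∀ {k} → α ≤ k → value (k + (a + b)) ≡ not (value (k + b) ∧ value (k + a))
    value-gameRule {k} α≤k = trans (value-rule (≤-trans α≤k (m≤m+n k (a + b))))
      (cong₂ (λ x y → not (value x ∧ value y)) (n≡m+o⇒n∸m≡o a (k + b) (x∙yz≈y∙xz k a b))
                                               (n≡m+o⇒n∸m≡o b (k + a) (x∙yz≈z∙xy k a b)))

    zero-recurs : ∀ {m} → α ≤ m → value m ≡ false → value (m + (a + b)) ≡ false
    zero-recurs {m} α≤m vm = value-false (≤-trans α≤m (m≤m+n m (a + b)))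
      (trans (cong value (n≡m+o⇒n∸m≡o a (m + b) (x∙yz≈y∙xz m a b))) m+b-true)
      (trans (cong value (n≡m+o⇒n∸m≡o b (m + a) (x∙yz≈z∙xy m a b))) m+a-true)
      where
      m+a-true : value (m + a) ≡ true
      m+a-true = value-true (≤-trans α≤m (m≤m+n m a)) (inj₁ (trans (cong value (m+n∸n≡m m a)) vm))
      m+b-true : value (m + b) ≡ true
      m+b-true = value-true (≤-trans α≤m (m≤m+n m b)) (inj₂ (trans (cong value (m+n∸n≡m m b)) vm))

    -- A 1 at position k is caused by a 0 at k − a or k − b, and that 0 recurs a + b later.
    value-periodic : ∀ {k} → α + α ≤ k → value (k + (a + b)) ≡ value k
    value-periodic {k} 2α≤k with value k in vk
    ... | false = zero-recurs (α+α≤⇒α≤ 2α≤k) vk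
    ... | true  = value-true (≤-trans (α+α≤⇒α≤ 2α≤k) (m≤m+n k (a + b)))
      (Sum.map (recurs a≤α) (recurs b≤α) (value-true⁻¹ (α+α≤⇒α≤ 2α≤k) vk))
      where
      recurs : ∀ {x} → x ≤ α → value (k ∸ x) ≡ false → value (k + (a + b) ∸ x) ≡ false
      recurs x≤α vx = trans (cong value (+-∸-comm (a + b) (≤-trans x≤α (α+α≤⇒α≤ 2α≤k))))
                            (zero-recurs (α+α≤⇒α≤∸ x≤α 2α≤k) vx)

  open Run using (value; value-gameRule; value-periodic)

  w-gameRule : ∀ s → GameRule a b (w a b s)
  w-gameRule s n = begin
    value s (n + (a + b) + α)                       ≡⟨ cong (value s) (xy∙z≈xz∙y n (a + b) α) ⟩
    value s (n + α + (a + b))                       ≡⟨ value-gameRule s (m≤n+m α n) ⟩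
    not (value s (n + α + b) ∧ value s (n + α + a)) ≡⟨ cong₂ (λ x y → not (value s x ∧ value s y))
                                                             (xy∙z≈xz∙y n α b) (xy∙z≈xz∙y n α a) ⟩
    not (value s (n + b + α) ∧ value s (n + a + α)) ∎

  shift-w-periodic : ∀ s → Periodic (a + b) (shift α (w a b s))
  shift-w-periodic s n = begin
    value s (n + (a + b) + α + α) ≡⟨ cong (λ k → value s (k + α)) (xy∙z≈xz∙y n (a + b) α) ⟩
    value s (n + α + (a + b) + α) ≡⟨ cong (value s) (xy∙z≈xz∙y (n + α) (a + b) α) ⟩
    value s (n + α + α + (a + b)) ≡⟨ value-periodic s (subst (α + α ≤_) (sym (+-assoc n α α))
                                                              (m≤n+m (α + α) n)) ⟩
    value s (n + α + α)           ∎

  -- The seed of an (a + b)-periodic u is the window u (−α) … u (−1), read at indices a + b − α ….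
  seedOf : Seq → Seed a b
  seedOf u i = u (toℕ i + ((a + b) ∸ α))

  private
    e : ℕ
    e = (a + b) ∸ α

    α+e : α + e ≡ a + b
    α+e = m+[n∸m]≡n (m⊔n≤m+n a b)

    k+e : ∀ {k} → α ≤ k → k + e ≡ k ∸ α + (a + b)
    k+e {k} α≤k = begin
      k + e             ≡⟨ cong (_+ e) (m∸n+n≡m α≤k) ⟨
      k ∸ α + α + e     ≡⟨ +-assoc (k ∸ α) α e ⟩
      k ∸ α + (α + e)   ≡⟨ cong (_+_ (k ∸ α)) α+e ⟩
      k ∸ α + (a + b)   ∎

    k∸x+e+x : ∀ {k x} → x ≤ α → α ≤ k → k ∸ x + e + x ≡ k ∸ α + (a + b)
    k∸x+e+x {k} {x} x≤α α≤k = begin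
      k ∸ x + e + x     ≡⟨ xy∙z≈xz∙y (k ∸ x) e x ⟩
      k ∸ x + x + e     ≡⟨ cong (_+ e) (m∸n+n≡m (≤-trans x≤α α≤k)) ⟩
      k + e             ≡⟨ k+e α≤k ⟩
      k ∸ α + (a + b)   ∎

  module _ {u : Seq} (rule : GameRule a b u) where

    vFuel-seedOf : ∀ f k → k < f → vFuel a b (seedOf u) f k ≡ u (k + e)
    vFuel-seedOf (suc f) k (s≤s k≤f) with k <? (a ⊔ b)
    ... | yes k<α = cong (λ i → u (i + e)) (Fin.toℕ-fromℕ< k<α)
    ... | no k≮α  = begin
      not (vFuel a b (seedOf u) f (k ∸ a) ∧ vFuel a b (seedOf u) f (k ∸ b))
        ≡⟨ cong₂ (λ x y → not (x ∧ y)) (vFuel-seedOf f (k ∸ a) (<-≤-trans (∸-< a≥1 a≤α α≤k) k≤f))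
                                       (vFuel-seedOf f (k ∸ b) (<-≤-trans (∸-< b≥1 b≤α α≤k) k≤f)) ⟩
      not (u (k ∸ a + e) ∧ u (k ∸ b + e))
        ≡⟨ cong₂ (λ x y → not (u x ∧ u y))
             (+-cancelʳ-≡ _ _ _ (trans (k∸x+e+x a≤α α≤k) (x∙yz≈xz∙y (k ∸ α) a b)))
             (+-cancelʳ-≡ _ _ _ (trans (k∸x+e+x b≤α α≤k) (sym (+-assoc (k ∸ α) a b)))) ⟩
      not (u (k ∸ α + b) ∧ u (k ∸ α + a))
        ≡⟨ rule (k ∸ α) ⟨
      u (k ∸ α + (a + b))
        ≡⟨ cong u (k+e α≤k) ⟨
      u (k + e) ∎
      where
      α≤k : α ≤ k
      α≤k = ≮⇒≥ k≮α

  w-seedOf : ∀ {u} → Periodic (a + b) u → CyclicGameRule a b u → w a b (seedOf u) ≗ u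
  w-seedOf {u} p rule n = begin
    vFuel a b (seedOf u) (suc (n + α)) (n + α) ≡⟨ vFuel-seedOf {u} (cyclicGameRule⇒gameRule p rule) _ _ ≤-refl ⟩
    u (n + α + e)                              ≡⟨ cong u (trans (+-assoc n α e) (cong (_+_ n) α+e)) ⟩
    u (n + (a + b))                            ≡⟨ p n ⟩
    u n                                        ∎

-- Reindexing along multiples of a

NeighbourRule : Seq → Set
NeighbourRule y = ∀ m → y (suc m) ≡ not (y m ∧ y (suc (suc m)))

dilate : ℕ → Seq → Seq
dilate k u n = u (k * n)

dilate-periodic : ∀ {ℓ u} k → Periodic ℓ u → Periodic ℓ (dilate k u)
dilate-periodic {ℓ} {u} k p n = trans (cong u (*-distribˡ-+ k n ℓ)) (periodic-+* p (k * n) k)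

-- c is an inverse of a modulo ℓ, witnessed without subtraction.
InverseMod : ℕ → ℕ → ℕ → Set
InverseMod ℓ a c = ∃₂ λ i j → a * c + i * ℓ ≡ 1 + j * ℓ

bézoutInverse : ∀ {g a ℓ} → Bézout.Identity g a ℓ → ℕ
bézoutInverse         (Bézout.+- x _ _) = x
bézoutInverse {ℓ = ℓ} (Bézout.-+ x _ _) = x * (ℓ ∸ 1)

bézoutInverse-inverseMod : ∀ {a ℓ} .{{_ : NonZero ℓ}} (I : Bézout.Identity 1 a ℓ) →
                           InverseMod ℓ a (bézoutInverse I)
bézoutInverse-inverseMod {a} {ℓ} (Bézout.+- x y eq) = 0 , y , (begin
  a * x + 0       ≡⟨ +-identityʳ (a * x) ⟩
  a * x           ≡⟨ *-comm a x ⟩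
  x * a           ≡⟨ eq ⟨
  1 + y * ℓ       ∎)
bézoutInverse-inverseMod {a} {suc k} (Bézout.-+ x y eq) = y , x * a , (begin
  a * (x * k) + y * suc k       ≡⟨ cong (_+_ (a * (x * k))) eq ⟨
  a * (x * k) + (1 + x * a)     ≡⟨ solve (a ∷ x ∷ k ∷ []) ⟩
  1 + x * a * suc k             ∎)

inverseMod : ℕ → ℕ → ℕ
inverseMod a ℓ = bézoutInverse (Bézout.identity (gcd-GCD a ℓ))

inverseMod-isInverse : ∀ {a ℓ} .{{_ : NonZero ℓ}} → Coprime a ℓ → InverseMod ℓ a (inverseMod a ℓ)
inverseMod-isInverse {a} {ℓ} coprime = from-gcd (coprime⇒gcd≡1 coprime) (Bézout.identity (gcd-GCD a ℓ))
  where
  from-gcd : ∀ {g} → g ≡ 1 → (I : Bézout.Identity g a ℓ) → InverseMod ℓ a (bézoutInverse I)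
  from-gcd refl I = bézoutInverse-inverseMod I

coprime-∣+ : ∀ {a b ℓ} → Coprime a b → ℓ ∣ a + b → Coprime a ℓ
coprime-∣+ coprime ℓ∣a+b (i∣a , i∣ℓ) = coprime (i∣a , ∣m+n∣m⇒∣n (∣-trans i∣ℓ ℓ∣a+b) i∣a)

-- Since b ≡ −a (mod ℓ), dilating by a turns CyclicGameRule into NeighbourRule, and dilating by
-- the inverse c of a turns it back.
module Reindex {a b ℓ c i j : ℕ} (ℓ∣a+b : ℓ ∣ a + b) (inverse : a * c + i * ℓ ≡ 1 + j * ℓ) where

  private
    k : ℕ
    k = _∣_.quotient ℓ∣a+b

  module _ {y : Seq} (p : Periodic ℓ y) where

    y[x+ac]≡y[x+1] : ∀ x → y (x + a * c) ≡ y (x + 1)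
    y[x+ac]≡y[x+1] x = periodic-≡ i j p (begin
      x + a * c + i * ℓ     ≡⟨ +-assoc x (a * c) (i * ℓ) ⟩
      x + (a * c + i * ℓ)   ≡⟨ cong (_+_ x) inverse ⟩
      x + (1 + j * ℓ)       ≡⟨ +-assoc x 1 (j * ℓ) ⟨
      x + 1 + j * ℓ         ∎)

    y[x+c[a+b]]≡y[x] : ∀ x → y (x + c * (a + b)) ≡ y x
    y[x+c[a+b]]≡y[x] x = begin
      y (x + c * (a + b))   ≡⟨ cong (λ m → y (x + c * m)) (_∣_.equality ℓ∣a+b) ⟩
      y (x + c * (k * ℓ))   ≡⟨ cong (λ m → y (x + m)) (*-assoc c k ℓ) ⟨
      y (x + c * k * ℓ)     ≡⟨ periodic-+* p x (c * k) ⟩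
      y x                   ∎

    y[s[tn]]≡y[n] : ∀ s t → (∀ n → s * (t * n) ≡ a * c * n) → ∀ n → y (s * (t * n)) ≡ y n
    y[s[tn]]≡y[n] s t st≡ac n = periodic-≡ (i * n) (j * n) p (begin
      s * (t * n) + i * n * ℓ     ≡⟨ cong (_+ i * n * ℓ) (st≡ac n) ⟩
      a * c * n + i * n * ℓ       ≡⟨ solve (a ∷ c ∷ i ∷ n ∷ ℓ ∷ []) ⟩
      (a * c + i * ℓ) * n         ≡⟨ cong (_* n) inverse ⟩
      (1 + j * ℓ) * n             ≡⟨ solve (j ∷ ℓ ∷ n ∷ []) ⟩
      n + j * n * ℓ               ∎)

  dilate-cyclicGameRule : ∀ {u} → Periodic ℓ u → CyclicGameRule a b u → NeighbourRule (dilate a u)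
  dilate-cyclicGameRule {u} p rule m = begin
    u (a * suc m)                                ≡⟨ cong u (solve (a ∷ m ∷ [])) ⟩
    u (a * m + a)                                ≡⟨ rule (a * m + a) ⟩
    not (u (a * m + a + a) ∧ u (a * m + a + b))
      ≡⟨ cong₂ (λ x y → not (x ∧ y)) (cong u (solve (a ∷ m ∷ [])))
                                     (trans (cong u (+-assoc (a * m) a b)) (periodic-∣ ℓ∣a+b p (a * m))) ⟩
    not (u (a * suc (suc m)) ∧ u (a * m))        ≡⟨ cong not (∧-comm (u (a * suc (suc m))) (u (a * m))) ⟩
    not (u (a * m) ∧ u (a * suc (suc m)))        ∎

  dilate-neighbourRule : ∀ {y} → Periodic ℓ y → NeighbourRule y → CyclicGameRule a b (dilate c y)
  dilate-neighbourRule {y} p rule n = begin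
    y (c * n)                                            ≡⟨ y[x+c[a+b]]≡y[x] p (c * n) ⟨
    y (c * n + c * (a + b))                              ≡⟨ cong y (solve (c ∷ n ∷ a ∷ b ∷ [])) ⟩
    y (c * (n + b) + a * c)                              ≡⟨ y[x+ac]≡y[x+1] p (c * (n + b)) ⟩
    y (c * (n + b) + 1)                                  ≡⟨ cong y (+-comm _ 1) ⟩
    y (suc (c * (n + b)))                                ≡⟨ rule (c * (n + b)) ⟩
    not (y (c * (n + b)) ∧ y (suc (suc (c * (n + b)))))  ≡⟨ cong (λ z → not (y (c * (n + b)) ∧ z)) two-after ⟩
    not (y (c * (n + b)) ∧ y (c * (n + a)))              ≡⟨ cong not (∧-comm (y (c * (n + b))) (y (c * (n + a)))) ⟩
    not (y (c * (n + a)) ∧ y (c * (n + b)))              ∎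
    where
    two-after : y (suc (suc (c * (n + b)))) ≡ y (c * (n + a))
    two-after = begin
      y (suc (suc (c * (n + b))))    ≡⟨ cong y (solve (c ∷ n ∷ b ∷ [])) ⟩
      y (c * (n + b) + 1 + 1)        ≡⟨ y[x+ac]≡y[x+1] p (c * (n + b) + 1) ⟨
      y (c * (n + b) + 1 + a * c)    ≡⟨ cong y (solve (c ∷ n ∷ a ∷ b ∷ [])) ⟩
      y (c * n + 1 + c * (a + b))    ≡⟨ y[x+c[a+b]]≡y[x] p (c * n + 1) ⟩
      y (c * n + 1)                  ≡⟨ y[x+ac]≡y[x+1] p (c * n) ⟨
      y (c * n + a * c)              ≡⟨ cong y (solve (c ∷ n ∷ a ∷ [])) ⟩
      y (c * (n + a))                ∎

  dilate-c∘dilate-a : ∀ {u} → Periodic ℓ u → dilate c (dilate a u) ≗ u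
  dilate-c∘dilate-a p = y[s[tn]]≡y[n] p a c (λ n → sym (*-assoc a c n))

  dilate-a∘dilate-c : ∀ {y} → Periodic ℓ y → dilate a (dilate c y) ≗ y
  dilate-a∘dilate-c p = y[s[tn]]≡y[n] p c a (λ n → solve (a ∷ c ∷ n ∷ []))

  dilate-enumerates : ∀ {ys} → Enumerates _≗_ (λ y → Periodic ℓ y × NeighbourRule y) ys →
                      Enumerates _≗_ (λ u → Periodic ℓ u × CyclicGameRule a b u) (map (dilate c) ys)
  dilate-enumerates E = record
    { sound    = All.map⁺ (All.map (λ (p , rule) → dilate-periodic c p , dilate-neighbourRule p rule) sound)
    ; distinct = AllPairs.map⁺ (allPairs-mapWith different sound distinct)
    ; complete = λ (p , rule) → Any.map⁺
        (Any.map (λ a·u≗y n → trans (sym (dilate-c∘dilate-a p n)) (a·u≗y (c * n)))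
                 (complete (dilate-periodic a p , dilate-cyclicGameRule p rule)))
    }
    where
    open Enumerates E
    different : ∀ {y y′} → Periodic ℓ y × NeighbourRule y → Periodic ℓ y′ × NeighbourRule y′ →
                ¬ y ≗ y′ → ¬ dilate c y ≗ dilate c y′
    different (p , _) (p′ , _) y≉y′ eq =
      y≉y′ λ n → trans (sym (dilate-a∘dilate-c p n)) (trans (eq (a * n)) (dilate-a∘dilate-c p′ n))

-- Closed walks and the numbers Q ℓ

-- Opened only from here on: the ring solver cannot read variable lists built from overloaded
-- constructors.
open All.All
open AllPairs.AllPairs

infixr 5 _∷ₛ_
_∷ₛ_ : Bool → Seq → Seq
(x ∷ₛ y) zero    = x
(x ∷ₛ y) (suc n) = y n

NeighbourRuleBelow : ℕ → Seq → Set
NeighbourRuleBelow n y = ∀ {i} → i < n → y (suc i) ≡ not (y i ∧ y (suc (suc i)))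

-- y 0 … y (n + 1) is a walk of length n from state (p , q) to state (p′ , q′), where the states
-- are pairs of consecutive bits.
record Path (n : ℕ) (p q p′ q′ : Bool) (y : Seq) : Set where
  constructor path
  field
    start : y 0 ≡ p × y 1 ≡ q
    end   : y n ≡ p′ × y (suc n) ≡ q′
    rule  : NeighbourRuleBelow n y

successors : Bool → Bool → List Bool
successors false true  = false ∷ true ∷ []
successors true  false = true ∷ []
successors true  true  = false ∷ []
successors false false = []

successors-sound : ∀ {p q r} → r ∈ successors p q → q ≡ not (p ∧ r)
successors-sound {false} {true}  (here refl)         = refl
successors-sound {false} {true}  (there (here refl)) = refl
successors-sound {true}  {false} (here refl)         = refl
successors-sound {true}  {true}  (here refl)         = refl

successors-complete : ∀ {p q r} → q ≡ not (p ∧ r) → r ∈ successors p q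
successors-complete {false} {r = false} refl = here refl
successors-complete {false} {r = true}  refl = there (here refl)
successors-complete {true}  {r = false} refl = here refl
successors-complete {true}  {r = true}  refl = here refl

successors-distinct : ∀ p q → AllPairs _≢_ (successors p q)
successors-distinct false true  = ((λ ()) ∷ []) ∷ [] ∷ []
successors-distinct true  false = [] ∷ []
successors-distinct true  true  = [] ∷ []
successors-distinct false false = []

paths : ℕ → Bool → Bool → Bool → Bool → List Seq
paths zero p q p′ q′ with p Bool.≟ p′ | q Bool.≟ q′
... | yes _ | yes _ = (p ∷ₛ q ∷ₛ λ _ → false) ∷ []
... | _     | _     = []
paths (suc n) p q p′ q′ = map (p ∷ₛ_) (concatMap (λ r → paths n q r p′ q′) (successors p q))

cons-path : ∀ {n p q r p′ q′ y} → q ≡ not (p ∧ r) → Path n q r p′ q′ y →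
            Path (suc n) p q p′ q′ (p ∷ₛ y)
cons-path {n} {p} {y = y} step (path (y₀ , y₁) end rule) = path (refl , y₀) end rule′
  where
  rule′ : NeighbourRuleBelow (suc n) (p ∷ₛ y)
  rule′ {zero}  _         = trans y₀ (trans step (cong (λ r → not (p ∧ r)) (sym y₁)))
  rule′ {suc i} (s≤s i<n) = rule i<n

tail-path : ∀ {n p q p′ q′ y} → Path (suc n) p q p′ q′ y →
            Path n q (y 2) p′ q′ (y ∘ suc) × q ≡ not (p ∧ y 2)
tail-path {y = y} (path (y₀ , y₁) end rule) =
  path (y₁ , refl) end (λ i<n → rule (s≤s i<n)) ,
  trans (sym y₁) (trans (rule (s≤s z≤n)) (cong (λ p → not (p ∧ y 2)) y₀))

paths-sound : ∀ n p q p′ q′ → All (Path n p q p′ q′) (paths n p q p′ q′)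
paths-sound zero p q p′ q′ with p Bool.≟ p′ | q Bool.≟ q′
... | yes refl | yes refl = path (refl , refl) (refl , refl) (λ ()) ∷ []
... | yes _    | no _     = []
... | no _     | _        = []
paths-sound (suc n) p q p′ q′ = All.map⁺ (concatMap-all⁺ (λ r → paths n q r p′ q′) (All.tabulate λ r∈ →
  All.map (cons-path (successors-sound r∈)) (paths-sound n q _ p′ q′)))

paths-complete : ∀ n p q p′ q′ {y} → Path n p q p′ q′ y → Any (AgreeBelow (2 + n) y) (paths n p q p′ q′)
paths-complete zero p q p′ q′ {y} (path (y₀ , y₁) (yₙ , y₁₊ₙ) _) with p Bool.≟ p′ | q Bool.≟ q′
... | yes refl | yes refl = here agree
  where
  agree : AgreeBelow 2 y (p ∷ₛ q ∷ₛ λ _ → false)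
  agree {zero}        _ = y₀
  agree {suc zero}    _ = y₁
  agree {suc (suc _)} (s≤s (s≤s ()))
... | no p≢p′ | _       = contradiction (trans (sym y₀) yₙ) p≢p′
... | yes _   | no q≢q′ = contradiction (trans (sym y₁) y₁₊ₙ) q≢q′
paths-complete (suc n) p q p′ q′ {y} y-path = Any.map⁺ (Any.concatMap⁺ (λ r → paths n q r p′ q′)
  (Any.map (λ { refl → Any.map cons-agree (paths-complete n q (y 2) p′ q′ (proj₁ (tail-path y-path))) })
           (successors-complete (proj₂ (tail-path y-path)))))
  where
  cons-agree : ∀ {z} → AgreeBelow (2 + n) (y ∘ suc) z → AgreeBelow (3 + n) y (p ∷ₛ z)
  cons-agree agree {zero}  _        = proj₁ (Path.start y-path)
  cons-agree agree {suc i} (s≤s i<) = agree i<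

paths-distinct : ∀ n p q p′ q′ → AllPairs (λ y z → ¬ AgreeBelow (2 + n) y z) (paths n p q p′ q′)
paths-distinct zero p q p′ q′ with p Bool.≟ p′ | q Bool.≟ q′
... | yes _ | yes _ = [] ∷ []
... | yes _ | no _  = []
... | no _  | _     = []
paths-distinct (suc n) p q p′ q′ = AllPairs.map⁺ (concatMap-allPairs⁺ (successors-distinct p q)
  (All.tabulate λ _ → AllPairs.map (λ ¬agree agree → ¬agree (λ i< → agree (s≤s i<)))
                                   (paths-distinct n q _ p′ q′))
  (All.tabulate λ {r} _ → All.map (proj₂ ∘ Path.start) (paths-sound n q r p′ q′))
  λ r≢r′ y₁ z₁ agree → r≢r′ (trans (sym y₁) (trans (agree (s≤s (s≤s (s≤s z≤n)))) z₁)))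

pathCount : ℕ → Bool → Bool → Bool → Bool → ℕ
pathCount zero    p     q     p′ q′ = length (paths zero p q p′ q′)
pathCount (suc n) false true  p′ q′ = pathCount n true false p′ q′ + pathCount n true true p′ q′
pathCount (suc n) true  false p′ q′ = pathCount n false true p′ q′
pathCount (suc n) true  true  p′ q′ = pathCount n true false p′ q′
pathCount (suc n) false false p′ q′ = 0

length-paths : ∀ n p q p′ q′ → length (paths n p q p′ q′) ≡ pathCount n p q p′ q′
length-paths zero    p q p′ q′ = refl
length-paths (suc n) p q p′ q′ = begin
  length (map (p ∷ₛ_) (concatMap extend (successors p q)))
    ≡⟨ length-map (p ∷ₛ_) (concatMap extend (successors p q)) ⟩
  length (concatMap extend (successors p q))
    ≡⟨ length-concatMap extend (successors p q) ⟩
  sum (map (length ∘ extend) (successors p q))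
    ≡⟨ cong sum (map-cong (λ r → length-paths n q r p′ q′) (successors p q)) ⟩
  sum (map (λ r → pathCount n q r p′ q′) (successors p q))
    ≡⟨ sum-successors p q ⟩
  pathCount (suc n) p q p′ q′ ∎
  where
  extend : Bool → List Seq
  extend r = paths n q r p′ q′
  sum-successors : ∀ p q →
                   sum (map (λ r → pathCount n q r p′ q′) (successors p q)) ≡ pathCount (suc n) p q p′ q′
  sum-successors false true  = cong (_+_ (pathCount n true false p′ q′)) (+-identityʳ _)
  sum-successors true  false = +-identityʳ _
  sum-successors true  true  = +-identityʳ _
  sum-successors false false = refl

pathCount-rec : ∀ m p q p′ q′ →
                pathCount (4 + m) p q p′ q′ ≡ pathCount (2 + m) p q p′ q′ + pathCount (1 + m) p q p′ q′
pathCount-rec m false true  p′ q′ = refl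
pathCount-rec m true  false p′ q′ = refl
pathCount-rec m true  true  p′ q′ = refl
pathCount-rec m false false p′ q′ = refl

states : List (Bool × Bool)
states = (false , false) ∷ (false , true) ∷ (true , false) ∷ (true , true) ∷ []

states-complete : ∀ p q → (p , q) ∈ states
states-complete false false = here refl
states-complete false true  = there (here refl)
states-complete true  false = there (there (here refl))
states-complete true  true  = there (there (there (here refl)))

states-distinct : AllPairs _≢_ states
states-distinct =
  ((λ ()) ∷ (λ ()) ∷ (λ ()) ∷ []) ∷ ((λ ()) ∷ (λ ()) ∷ []) ∷ ((λ ()) ∷ []) ∷ [] ∷ []

loops : ℕ → Bool × Bool → List Seq
loops ℓ (p , q) = paths ℓ p q p q

loopCount : ℕ → Bool × Bool → ℕ
loopCount ℓ (p , q) = pathCount ℓ p q p q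

allLoops : ℕ → List Seq
allLoops ℓ = concatMap (loops ℓ) states

-- The number of closed walks of length ℓ is the trace of the ℓ-th power of the transfer matrix,
-- whose characteristic polynomial is x (x³ − x − 1); hence it is Q ℓ for ℓ ≥ 1.
allLoopCount : ℕ → ℕ
allLoopCount ℓ = sum (map (loopCount ℓ) states)

length-allLoops : ∀ ℓ → length (allLoops ℓ) ≡ allLoopCount ℓ
length-allLoops ℓ = trans (length-concatMap (loops ℓ) states)
                          (cong sum (map-cong (λ (p , q) → length-paths ℓ p q p q) states))

allLoopCount-rec : ∀ m → allLoopCount (4 + m) ≡ allLoopCount (2 + m) + allLoopCount (1 + m)
allLoopCount-rec m = begin
  sum (map (loopCount (4 + m)) states)
    ≡⟨ cong sum (map-cong (λ (p , q) → pathCount-rec m p q p q) states) ⟩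
  sum (map (λ s → loopCount (2 + m) s + loopCount (1 + m) s) states)
    ≡⟨ sum-map-+ (loopCount (2 + m)) (loopCount (1 + m)) states ⟩
  allLoopCount (2 + m) + allLoopCount (1 + m) ∎

allLoopCount≡Q : ∀ m → + allLoopCount (suc m) ≡ Q (suc m)
allLoopCount≡Q zero                = refl
allLoopCount≡Q (suc zero)          = refl
allLoopCount≡Q (suc (suc zero))    = refl
allLoopCount≡Q (suc (suc (suc m))) = begin
  + allLoopCount (4 + m)                              ≡⟨ cong +_ (allLoopCount-rec m) ⟩
  + (allLoopCount (2 + m) + allLoopCount (1 + m))
    ≡⟨ ℤ.pos-+ (allLoopCount (2 + m)) (allLoopCount (1 + m)) ⟩
  + allLoopCount (2 + m) ℤ.+ + allLoopCount (1 + m)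
    ≡⟨ cong₂ ℤ._+_ (allLoopCount≡Q (suc m)) (allLoopCount≡Q m) ⟩
  Q (4 + m)                                           ∎

periodize : (ℓ : ℕ) .{{_ : NonZero ℓ}} → Seq → Seq
periodize ℓ y n = y (n % ℓ)

periodize-periodic : ∀ ℓ .{{_ : NonZero ℓ}} y → Periodic ℓ (periodize ℓ y)
periodize-periodic ℓ y n = cong y ([m+n]%n≡m%n n ℓ)

periodize-at-1 : ∀ ℓ .{{_ : NonZero ℓ}} {p q y} → Path ℓ p q p q y → periodize ℓ y 1 ≡ y 1
periodize-at-1 (suc zero)    (path (y₀ , _) (y₁ , _) _) = trans y₀ (sym y₁)
periodize-at-1 (suc (suc _)) _                          = refl

periodize-agree : ∀ ℓ .{{_ : NonZero ℓ}} {p q y} → Path ℓ p q p q y → AgreeBelow (2 + ℓ) (periodize ℓ y) y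
periodize-agree ℓ {y = y} y-path@(path (y₀ , y₁) (yℓ , y₁₊ℓ) _) i<2+ℓ
  with m≤n⇒m<n∨m≡n (s≤s⁻¹ i<2+ℓ)
... | inj₂ refl = begin
  periodize ℓ y (1 + ℓ)  ≡⟨ periodize-periodic ℓ y 1 ⟩
  periodize ℓ y 1        ≡⟨ periodize-at-1 ℓ y-path ⟩
  y 1                    ≡⟨ trans y₁ (sym y₁₊ℓ) ⟩
  y (1 + ℓ)              ∎
... | inj₁ i<1+ℓ with m≤n⇒m<n∨m≡n (s≤s⁻¹ i<1+ℓ)
...   | inj₁ i<ℓ  = cong y (m<n⇒m%n≡m i<ℓ)
...   | inj₂ refl = trans (cong y (n%n≡0 ℓ)) (trans y₀ (sym yℓ))

periodize-neighbourRule : ∀ ℓ .{{_ : NonZero ℓ}} {p q y} → Path ℓ p q p q y → NeighbourRule (periodize ℓ y)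
periodize-neighbourRule ℓ {y = y} y-path@(path _ _ rule) m = begin
  z (1 + m)               ≡⟨ periodic-% (periodize-periodic ℓ y) 1 m ⟩
  z (1 + i)               ≡⟨ agree (s≤s (m≤n⇒m≤1+n i<ℓ)) ⟩
  y (1 + i)               ≡⟨ rule i<ℓ ⟩
  not (y i ∧ y (2 + i))   ≡⟨ cong₂ (λ x x′ → not (x ∧ x′)) (agree (<-≤-trans i<ℓ (m≤n+m ℓ 2)))
                                                            (agree (s≤s (s≤s i<ℓ))) ⟨
  not (z i ∧ z (2 + i))   ≡⟨ cong₂ (λ x x′ → not (x ∧ x′)) (periodic-% (periodize-periodic ℓ y) 0 m)
                                                            (periodic-% (periodize-periodic ℓ y) 2 m) ⟨
  not (z m ∧ z (2 + m))   ∎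
  where
  z : Seq
  z = periodize ℓ y
  i : ℕ
  i = m % ℓ
  i<ℓ : i < ℓ
  i<ℓ = m%n<n m ℓ
  agree : AgreeBelow (2 + ℓ) z y
  agree = periodize-agree ℓ y-path

module _ (ℓ : ℕ) .{{_ : NonZero ℓ}} where

  allLoops-sound : All (λ y → ∃₂ λ p q → Path ℓ p q p q y) (allLoops ℓ)
  allLoops-sound = concatMap-all⁺ (loops ℓ) {states}
    (All.tabulate λ {(p , q)} _ → All.map (λ y-path → p , q , y-path) (paths-sound ℓ p q p q))

  allLoops-distinct : AllPairs (λ y z → ¬ AgreeBelow (2 + ℓ) y z) (allLoops ℓ)
  allLoops-distinct = concatMap-allPairs⁺ states-distinct
    (All.tabulate λ {(p , q)} _ → paths-distinct ℓ p q p q)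
    (All.tabulate λ {(p , q)} _ → All.map Path.start (paths-sound ℓ p q p q))
    λ s≢s′ (y₀ , y₁) (z₀ , z₁) agree →
      s≢s′ (cong₂ _,_ (trans (sym y₀) (trans (agree (s≤s z≤n)) z₀))
                      (trans (sym y₁) (trans (agree (s≤s (s≤s z≤n))) z₁)))

  allLoops-complete : ∀ {p q y} → Path ℓ p q p q y → Any (AgreeBelow (2 + ℓ) y) (allLoops ℓ)
  allLoops-complete {p} {q} y-path = Any.concatMap⁺ (loops ℓ)
    (Any.map (λ { refl → paths-complete ℓ p q p q y-path }) (states-complete p q))

  neighbourSolutions : List Seq
  neighbourSolutions = map (periodize ℓ) (allLoops ℓ)

  neighbourSolutions-enumerates : Enumerates _≗_ (λ z → Periodic ℓ z × NeighbourRule z) neighbourSolutions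
  neighbourSolutions-enumerates = record
    { sound    = All.map⁺ (All.map (λ {y} (_ , _ , y-path) →
                                      periodize-periodic ℓ y , periodize-neighbourRule ℓ y-path) allLoops-sound)
    ; distinct = AllPairs.map⁺ (allPairs-mapWith different allLoops-sound allLoops-distinct)
    ; complete = λ (p , rule) → Any.map⁺ (Any.map (λ agree n → trans (periodic-% p 0 n) (agree (i<2+ℓ n)))
                                                   (allLoops-complete (closed-path p rule)))
    }
    where
    different : ∀ {y y′} → ∃₂ (λ p q → Path ℓ p q p q y) → ∃₂ (λ p q → Path ℓ p q p q y′) →
                ¬ AgreeBelow (2 + ℓ) y y′ → ¬ periodize ℓ y ≗ periodize ℓ y′
    different (_ , _ , y-path) (_ , _ , y′-path) ¬agree eq =
      ¬agree λ i< → trans (sym (periodize-agree ℓ y-path i<)) (trans (eq _) (periodize-agree ℓ y′-path i<))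
    closed-path : ∀ {z} → Periodic ℓ z → NeighbourRule z → Path ℓ (z 0) (z 1) (z 0) (z 1) z
    closed-path p rule = path (refl , refl) (p 0 , p 1) (λ _ → rule _)
    i<2+ℓ : ∀ n → n % ℓ < 2 + ℓ
    i<2+ℓ n = <-≤-trans (m%n<n n ℓ) (m≤n+m ℓ 2)

  length-neighbourSolutions : length neighbourSolutions ≡ allLoopCount ℓ
  length-neighbourSolutions = trans (length-map (periodize ℓ) (allLoops ℓ)) (length-allLoops ℓ)

-- Shift orbits

∈-divisors⁻ : ∀ {d ℓ} → d ∈ divisors ℓ → ∃[ k ] d ≡ suc k × d ∣ ℓ
∈-divisors⁻ {ℓ = ℓ} d∈ with ∈-filter⁻ (_∣? ℓ) {xs = map suc (upTo ℓ)} d∈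
... | d∈suc , d∣ℓ with ∈-map⁻ suc d∈suc
...   | k , _ , d≡1+k = k , d≡1+k , d∣ℓ

∈-divisors⁺ : ∀ {d ℓ} .{{_ : NonZero ℓ}} → NonZero d → d ∣ ℓ → d ∈ divisors ℓ
∈-divisors⁺ {suc k} {ℓ} _ d∣ℓ = ∈-filter⁺ (_∣? ℓ) (∈-map⁺ suc (∈-upTo⁺ (∣⇒≤ d∣ℓ))) d∣ℓ

divisors-unique : ∀ ℓ → AllPairs _≢_ (divisors ℓ)
divisors-unique ℓ = Unique.filter⁺ (_∣? ℓ) (Unique.map⁺ suc-injective (Unique.upTo⁺ ℓ))

rotations : ℕ → Seq → List Seq
rotations d r = map (λ t → shift t r) (upTo d)

length-rotations : ∀ d r → length (rotations d r) ≡ d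
length-rotations d r = trans (length-map (λ t → shift t r) (upTo d)) (length-upTo d)

rotations-distinct : ∀ {d r} → IsLeastPeriod r d → AllPairs (λ x y → ¬ x ≗ y) (rotations d r)
rotations-distinct lp = AllPairs.map⁺ (allPairs-mapWith
  (λ i<d j<d i≢j eq → i≢j (shift-injective lp i<d j<d eq)) (All.tabulate ∈-upTo⁻) (Unique.upTo⁺ _))

module Orbits
  (P : Seq → Set) (P-shift : ∀ {u} t → P u → P (shift t u))
  (M : ℕ) (E : ℕ → List Seq)
  (E-enumerates : ∀ ℓ .{{_ : NonZero ℓ}} → ℓ ∣ M → Enumerates _≗_ (λ u → Periodic ℓ u × P u) (E ℓ))
  where

  primitives : ℕ → List Seq
  primitives d = filter (¬? ∘ hasSmallerPeriod? d) (E d)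

  orbitReps : ℕ → List Seq
  orbitReps d = nubBy (rotates? d) (primitives d)

  Representative : ℕ → Seq → Set
  Representative d r = (Periodic d r × P r) × IsLeastPeriod r d

  module _ (d : ℕ) .{{_ : NonZero d}} (d∣M : d ∣ M) where

    open Enumerates (E-enumerates d d∣M)

    primitives-sound : All (Representative d) (primitives d)
    primitives-sound = All.zipWith
      (λ ((p , Pr) , none) → (p , Pr) , ¬hasSmallerPeriod⇒leastPeriod (>-nonZero⁻¹ d , p) none)
      (All.filter⁺ (¬? ∘ hasSmallerPeriod? d) sound , All.all-filter (¬? ∘ hasSmallerPeriod? d) (E d))

    primitives-complete : ∀ {u} → P u → IsLeastPeriod u d → Any (u ≗_) (primitives d)
    primitives-complete Pu lp@((_ , p) , _) with complete (p , Pu)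
    ... | hit with Any.filter⁺ (¬? ∘ hasSmallerPeriod? d) hit
    ...   | inj₁ found    = found
    ...   | inj₂ excluded =
      contradiction (leastPeriod⇒¬hasSmallerPeriod (leastPeriod-resp (Any.lookup-result hit) lp)) excluded

    orbitReps-sound : All (Representative d) (orbitReps d)
    orbitReps-sound = nubBy⁺ (rotates? d) primitives-sound

    orbitReps-distinct : AllPairs (λ r s → ¬ Similar r s) (orbitReps d)
    orbitReps-distinct = allPairs-mapWith
      (λ ((pr , _) , _) ((ps , _) , _) ¬rot sim → ¬rot (similar⇒rotates pr ps sim))
      orbitReps-sound (nubBy-unrelated (rotates? d) (primitives d))

    orbitReps-complete : ∀ {u} → P u → IsLeastPeriod u d → Any (Similar u) (orbitReps d)
    orbitReps-complete {u} Pu lp = any-mapWith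
      (λ ((pr , _) , _) rot → similar-resp (sym ∘ u≗x) (λ _ → refl) (rotates⇒similar px pr rot))
      orbitReps-sound x-covered
      where
      hit : Any (u ≗_) (primitives d)
      hit = primitives-complete Pu lp
      u≗x : u ≗ Any.lookup hit
      u≗x = Any.lookup-result hit
      px : Periodic d (Any.lookup hit)
      px = proj₁ (proj₁ (proj₁ (All.lookupAny primitives-sound hit)))
      x-covered : Any (Rotates d (Any.lookup hit)) (orbitReps d)
      x-covered = proj₁ (All.lookupAny (nubBy-covers (rotates? d) (λ _ → rotates-refl) primitives-sound) hit)

  shift-representative : ∀ {d r} t → Representative d r → Representative d (shift t r)
  shift-representative t ((p , Pr) , lp) = (shift-periodic t p , P-shift t Pr) , shift-leastPeriod t lp

  withLeastPeriod : ℕ → List Seq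
  withLeastPeriod d = concatMap (rotations d) (orbitReps d)

  length-withLeastPeriod : ∀ d → length (withLeastPeriod d) ≡ d * length (orbitReps d)
  length-withLeastPeriod d = begin
    length (withLeastPeriod d)                      ≡⟨ length-concatMap (rotations d) (orbitReps d) ⟩
    sum (map (length ∘ rotations d) (orbitReps d))  ≡⟨ cong sum (map-cong (length-rotations d) (orbitReps d)) ⟩
    sum (map (λ _ → d) (orbitReps d))               ≡⟨ sum-map-const d (orbitReps d) ⟩
    d * length (orbitReps d)                        ∎

  module _ (d : ℕ) .{{_ : NonZero d}} (d∣M : d ∣ M) where

    withLeastPeriod-sound : All (Representative d) (withLeastPeriod d)
    withLeastPeriod-sound = concatMap-all⁺ (rotations d)
      (All.map (λ rep → All.map⁺ (All.tabulate λ {t} _ → shift-representative t rep)) (orbitReps-sound d d∣M))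

    withLeastPeriod-distinct : AllPairs (λ x y → ¬ x ≗ y) (withLeastPeriod d)
    withLeastPeriod-distinct = concatMap-allPairs⁺ {Q = λ r x → Periodic d r × Shifts r x}
      (orbitReps-distinct d d∣M)
      (All.map (rotations-distinct ∘ proj₂) (orbitReps-sound d d∣M))
      (All.map (λ ((p , _) , _) → All.map⁺ (All.tabulate λ {t} _ → p , shiftBy t (λ _ → refl)))
               (orbitReps-sound d d∣M))
      λ ¬sim (_ , r→x) (p′ , r′→y) x≗y →
        ¬sim (shifts⇒similar (shifts-trans r→x (shifts-trans (≗⇒shifts x≗y) (shifts-sym p′ r′→y))))

    withLeastPeriod-complete : ∀ {u} → P u → IsLeastPeriod u d → Any (u ≗_) (withLeastPeriod d)
    withLeastPeriod-complete {u} Pu lp@((_ , pu) , _) = Any.concatMap⁺ (rotations d)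
      (any-mapWith (λ ((pr , _) , _) sim → in-rotations pr (proj₂ (similar⇒shifts pu pr sim)))
                   (orbitReps-sound d d∣M) (orbitReps-complete d d∣M Pu lp))
      where
      in-rotations : ∀ {r} → Periodic d r → Shifts r u → Any (u ≗_) (rotations d r)
      in-rotations pr (shiftBy t r→u) =
        Any.map⁺ (Any.map (λ { refl n → trans (sym (r→u n)) (shift-% pr t n) }) (∈-upTo⁺ (m%n<n t d)))

  orbits : ℕ → List Seq
  orbits ℓ = concatMap withLeastPeriod (divisors ℓ)

  module _ (ℓ : ℕ) .{{_ : NonZero ℓ}} (ℓ∣M : ℓ ∣ M) where

    private
      divisor-block : ∀ {d} → d ∈ divisors ℓ →
        All (λ u → IsLeastPeriod u d × Periodic ℓ u × P u) (withLeastPeriod d) ×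
        AllPairs (λ x y → ¬ x ≗ y) (withLeastPeriod d)
      divisor-block d∈ with ∈-divisors⁻ {ℓ = ℓ} d∈
      ... | k , refl , d∣ℓ =
        All.map (λ ((p , Pu) , lp) → lp , periodic-∣ d∣ℓ p , Pu)
                (withLeastPeriod-sound (suc k) (∣-trans d∣ℓ ℓ∣M)) ,
        withLeastPeriod-distinct (suc k) (∣-trans d∣ℓ ℓ∣M)

    orbits-complete : ∀ {u} → Periodic ℓ u × P u → Any (u ≗_) (orbits ℓ)
    orbits-complete (p , Pu) with leastPeriod-exists ℓ (>-nonZero⁻¹ ℓ , p)
    ... | d , lp@((d≥1 , _) , _) = Any.concatMap⁺ withLeastPeriod
      (Any.map (λ { refl → withLeastPeriod-complete d (∣-trans d∣ℓ ℓ∣M) Pu lp }) (∈-divisors⁺ it d∣ℓ))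
      where
      instance
        d≢0 : NonZero d
        d≢0 = >-nonZero d≥1
      d∣ℓ : d ∣ ℓ
      d∣ℓ = leastPeriod-∣ lp p

    orbits-enumerates : Enumerates _≗_ (λ u → Periodic ℓ u × P u) (orbits ℓ)
    orbits-enumerates = record
      { sound    = concatMap-all⁺ withLeastPeriod (All.tabulate (All.map proj₂ ∘ proj₁ ∘ divisor-block))
      ; distinct = concatMap-allPairs⁺ (divisors-unique ℓ) (All.tabulate (proj₂ ∘ divisor-block))
          (All.tabulate (All.map proj₁ ∘ proj₁ ∘ divisor-block))
          λ d≢d′ lpx lpy x≗y → d≢d′ (leastPeriod-unique (leastPeriod-resp x≗y lpx) lpy)
      ; complete = orbits-complete
      }

    orbitReps-count : sum (map (λ d → d * length (orbitReps d)) (divisors ℓ)) ≡ length (E ℓ)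
    orbitReps-count = begin
      sum (map (λ d → d * length (orbitReps d)) (divisors ℓ))
        ≡⟨ cong sum (map-cong length-withLeastPeriod (divisors ℓ)) ⟨
      sum (map (length ∘ withLeastPeriod) (divisors ℓ))
        ≡⟨ length-concatMap withLeastPeriod (divisors ℓ) ⟨
      length (orbits ℓ)
        ≡⟨ enumerates-length (λ eq → sym ∘ eq) (λ eq eq′ n → trans (eq n) (eq′ n))
                             orbits-enumerates (E-enumerates ℓ ℓ∣M) ⟩
      length (E ℓ) ∎

-- The recursion defining N'

sumℤ-map≡+sum : ∀ {A : Set} {f : A → ℤ.ℤ} {g : A → ℕ} {xs} →
                All (λ x → f x ≡ + g x) xs → sumℤ (map f xs) ≡ + sum (map g xs)
sumℤ-map≡+sum []                           = refl
sumℤ-map≡+sum {g = g} {x ∷ xs} (fx≡ ∷ fxs≡) =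
  trans (cong₂ ℤ._+_ fx≡ (sumℤ-map≡+sum fxs≡)) (sym (ℤ.pos-+ (g x) (sum (map g xs))))

+[m+n]-+m≡+n : ∀ m n → + (m + n) ℤ.- + m ≡ + n
+[m+n]-+m≡+n m n = trans (ℤ.m-n≡m⊖n (m + n) m) (trans (ℤ.⊖-≥ (m≤m+n m n)) (cong +_ (m+n∸m≡n m n)))

divisors-split : ∀ m → divisors (suc m) ≡ properDivisors (suc m) ++ suc m ∷ []
divisors-split m = begin
  filter (_∣? suc m) (map suc (upTo (suc m)))
    ≡⟨ cong (filter (_∣? suc m) ∘ map suc) (upTo-∷ʳ m) ⟨
  filter (_∣? suc m) (map suc (upTo m ++ m ∷ []))
    ≡⟨ cong (filter (_∣? suc m)) (map-++ suc (upTo m) (m ∷ [])) ⟩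
  filter (_∣? suc m) (map suc (upTo m) ++ suc m ∷ [])
    ≡⟨ filter-++ (_∣? suc m) (map suc (upTo m)) (suc m ∷ []) ⟩
  properDivisors (suc m) ++ filter (_∣? suc m) (suc m ∷ [])
    ≡⟨ cong (properDivisors (suc m) ++_) (filter-accept (_∣? suc m) ∣-refl) ⟩
  properDivisors (suc m) ++ suc m ∷ [] ∎

∈-properDivisors⁻ : ∀ {d m} → d ∈ properDivisors (suc m) → ∃[ k ] d ≡ suc k × k < m × d ∣ suc m
∈-properDivisors⁻ {m = m} d∈ with ∈-filter⁻ (_∣? suc m) {xs = map suc (upTo m)} d∈
... | d∈suc , d∣ with ∈-map⁻ suc d∈suc
...   | k , k∈ , d≡1+k = k , d≡1+k , ∈-upTo⁻ k∈ , d∣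

module _ (c : ℕ → ℕ) (M : ℕ)
  (divisor-sum : ∀ ℓ .{{_ : NonZero ℓ}} → ℓ ∣ M → + sum (map (λ d → d * c d) (divisors ℓ)) ≡ Q ℓ) where

  N'Fuel-solution : ∀ f ℓ .{{_ : NonZero ℓ}} → ℓ ≤ f → ℓ ∣ M → N'Fuel f ℓ ≡ + c ℓ
  N'Fuel-solution (suc f) (suc m) (s≤s m≤f) ℓ∣M = begin
    (Q (suc m) ℤ.- sumℤ (map (λ d → + d ℤ.* N'Fuel f d) (properDivisors (suc m)))) ℤ./ℕ suc m
      ≡⟨ cong₂ (λ x y → (x ℤ.- y) ℤ./ℕ suc m) Q≡ proper-sum ⟩
    (+ (S + suc m * c (suc m)) ℤ.- + S) ℤ./ℕ suc m
      ≡⟨ cong (ℤ._/ℕ suc m) (+[m+n]-+m≡+n S (suc m * c (suc m))) ⟩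
    + (suc m * c (suc m) / suc m)
      ≡⟨ cong +_ (trans (cong (_/ suc m) (*-comm (suc m) (c (suc m)))) (m*n/n≡m (c (suc m)) (suc m))) ⟩
    + c (suc m) ∎
    where
    term : ℕ → ℕ
    term d = d * c d
    S : ℕ
    S = sum (map term (properDivisors (suc m)))
    divisor-sum-split : sum (map term (divisors (suc m))) ≡ S + suc m * c (suc m)
    divisor-sum-split = begin
      sum (map term (divisors (suc m)))
        ≡⟨ cong (sum ∘ map term) (divisors-split m) ⟩
      sum (map term (properDivisors (suc m) ++ suc m ∷ []))
        ≡⟨ cong sum (map-++ term (properDivisors (suc m)) _) ⟩
      sum (map term (properDivisors (suc m)) ++ term (suc m) ∷ [])
        ≡⟨ sum-++ (map term (properDivisors (suc m))) _ ⟩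
      S + (suc m * c (suc m) + 0)
        ≡⟨ cong (_+_ S) (+-identityʳ _) ⟩
      S + suc m * c (suc m) ∎
    Q≡ : Q (suc m) ≡ + (S + suc m * c (suc m))
    Q≡ = trans (sym (divisor-sum (suc m) ℓ∣M)) (cong +_ divisor-sum-split)
    proper-term : ∀ {d} → ∃[ k ] d ≡ suc k × k < m × d ∣ suc m → + d ℤ.* N'Fuel f d ≡ + term d
    proper-term (k , refl , k<m , d∣) = begin
      + suc k ℤ.* N'Fuel f (suc k)
        ≡⟨ cong (+ suc k ℤ.*_) (N'Fuel-solution f (suc k) (≤-trans k<m m≤f) (∣-trans d∣ ℓ∣M)) ⟩
      + suc k ℤ.* + c (suc k)
        ≡⟨ ℤ.pos-* (suc k) (c (suc k)) ⟨
      + term (suc k) ∎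
    proper-sum : sumℤ (map (λ d → + d ℤ.* N'Fuel f d) (properDivisors (suc m))) ≡ + S
    proper-sum = sumℤ-map≡+sum (All.tabulate (proper-term ∘ ∈-properDivisors⁻))

  N'-solution : ∀ ℓ .{{_ : NonZero ℓ}} → ℓ ∣ M → N' ℓ ≡ + c ℓ
  N'-solution ℓ = N'Fuel-solution ℓ ℓ ≤-refl

module Periodicities (a b : ℕ) (a≥1 : 1 ≤ a) (b≥1 : 1 ≤ b) (coprime : Coprime a b) where

  open Game a b a≥1 b≥1

  numClasses-fromReps : ∀ {P : Seq → Set} → (∀ {u v} → u ≗ v → P u → P v) → ∀ xs →
    All (λ r → (Periodic (a + b) r × CyclicGameRule a b r) × P r) xs →
    AllPairs (λ r s → ¬ Similar r s) xs →
    (∀ s → P (w a b s) → Any (Similar (w a b s)) xs) →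
    NumClasses a b P (length xs)
  numClasses-fromReps {P} P-resp xs sound distinct complete = seed , P-seed , seed-distinct , seed-complete
    where
    seed : Fin (length xs) → Seed a b
    seed i = seedOf (lookup xs i)
    w-seed : ∀ i → w a b (seed i) ≗ lookup xs i
    w-seed i with All.lookup sound (∈-lookup i)
    ... | (p , rule) , _ = w-seedOf p rule
    P-seed : ∀ i → P (w a b (seed i))
    P-seed i = P-resp (sym ∘ w-seed i) (proj₂ (All.lookup sound (∈-lookup i)))
    seed-distinct : ∀ i j → Similar (w a b (seed i)) (w a b (seed j)) → i ≡ j
    seed-distinct i j sim =
      allPairs-lookup-injective similar-sym distinct i j (similar-resp (w-seed i) (w-seed j) sim)
    seed-complete : ∀ s → P (w a b s) → Σ (Fin (length xs)) λ i → Similar (w a b s) (w a b (seed i))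
    seed-complete s Ps with complete s Ps
    ... | hit = Any.index hit , similar-resp (λ _ → refl) (sym ∘ w-seed (Any.index hit)) (Any.lookup-index hit)

  solutions : ℕ → List Seq
  solutions zero      = []
  solutions ℓ@(suc _) = map (dilate (inverseMod a ℓ)) (neighbourSolutions ℓ)

  solutions-enumerates : ∀ ℓ .{{_ : NonZero ℓ}} → ℓ ∣ a + b →
                         Enumerates _≗_ (λ u → Periodic ℓ u × CyclicGameRule a b u) (solutions ℓ)
  solutions-enumerates ℓ@(suc _) ℓ∣a+b with inverseMod-isInverse (coprime-∣+ coprime ℓ∣a+b)
  ... | i , j , inverse = Reindex.dilate-enumerates {i = i} {j = j} ℓ∣a+b inverse (neighbourSolutions-enumerates ℓ)

  length-solutions : ∀ ℓ .{{_ : NonZero ℓ}} → length (solutions ℓ) ≡ allLoopCount ℓ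
  length-solutions ℓ@(suc _) = trans (length-map _ (neighbourSolutions ℓ)) (length-neighbourSolutions ℓ)

  open Orbits (CyclicGameRule a b) shift-cyclicGameRule (a + b) solutions solutions-enumerates

  divisor-sum : ∀ ℓ .{{_ : NonZero ℓ}} → ℓ ∣ a + b →
                + sum (map (λ d → d * length (orbitReps d)) (divisors ℓ)) ≡ Q ℓ
  divisor-sum ℓ@(suc m) ℓ∣a+b =
    trans (cong +_ (trans (orbitReps-count ℓ ℓ∣a+b) (length-solutions ℓ))) (allLoopCount≡Q m)

  N'≡#orbitReps : ∀ ℓ .{{_ : NonZero ℓ}} → ℓ ∣ a + b → N' ℓ ≡ + length (orbitReps ℓ)
  N'≡#orbitReps = N'-solution (length ∘ orbitReps) (a + b) divisor-sum

  periodicitiesOfLength : ∀ ℓ → 1 ≤ ℓ → ℓ ∣ a + b →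
                          Σ ℕ (λ n → NumPeriodicitiesOfLength a b ℓ n × + n ≡ N' ℓ)
  periodicitiesOfLength ℓ ℓ≥1 ℓ∣a+b = length (orbitReps ℓ) ,
    numClasses-fromReps leastPeriod-resp (orbitReps ℓ)
      (All.map (λ ((p , rule) , lp) → (periodic-∣ ℓ∣a+b p , rule) , lp) (orbitReps-sound ℓ ℓ∣a+b))
      (orbitReps-distinct ℓ ℓ∣a+b)
      (λ s lp → orbitReps-complete ℓ ℓ∣a+b (w-cyclicGameRule s (proj₂ (proj₁ lp))) lp) ,
    sym (N'≡#orbitReps ℓ ℓ∣a+b)
    where
    instance
      ℓ≢0 : NonZero ℓ
      ℓ≢0 = >-nonZero ℓ≥1
    w-cyclicGameRule : ∀ s → Periodic ℓ (w a b s) → CyclicGameRule a b (w a b s)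
    w-cyclicGameRule s p = gameRule⇒cyclicGameRule (periodic-∣ ℓ∣a+b p) (w-gameRule s)

  private
    instance
      a+b≢0 : NonZero (a + b)
      a+b≢0 = >-nonZero (≤-trans a≥1 (m≤m+n a b))

    divisor-reps : ∀ {d} → d ∈ divisors (a + b) →
      All (λ r → (Periodic (a + b) r × CyclicGameRule a b r) × IsLeastPeriod r d) (orbitReps d) ×
      AllPairs (λ r s → ¬ Similar r s) (orbitReps d) × N' d ≡ + length (orbitReps d)
    divisor-reps {d} d∈ with ∈-divisors⁻ {ℓ = a + b} d∈
    ... | k , refl , d∣a+b =
      All.map (λ ((p , rule) , lp) → (periodic-∣ d∣a+b p , rule) , lp) (orbitReps-sound d d∣a+b) ,
      orbitReps-distinct d d∣a+b , N'≡#orbitReps d d∣a+b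

  allReps : List Seq
  allReps = concatMap orbitReps (divisors (a + b))

  -- A game sequence is similar to its periodic tail, hence to that tail's orbit representative.
  w-similar-allReps : ∀ s → Any (Similar (w a b s)) allReps
  w-similar-allReps s with leastPeriod-exists (a + b) (>-nonZero⁻¹ (a + b) , shift-w-periodic s)
  ... | d , lp@((d≥1 , _) , _) = Any.concatMap⁺ orbitReps
    (Any.map (λ { refl → any-mapWith untail (orbitReps-sound d d∣a+b) (orbitReps-complete d d∣a+b tail-rule lp) })
             (∈-divisors⁺ it d∣a+b))
    where
    instance
      d≢0 : NonZero d
      d≢0 = >-nonZero d≥1
    d∣a+b : d ∣ a + b
    d∣a+b = leastPeriod-∣ lp (shift-w-periodic s)
    tail-rule : CyclicGameRule a b (shift α (w a b s))
    tail-rule = gameRule⇒cyclicGameRule (shift-w-periodic s) (shift-gameRule {u = w a b s} α (w-gameRule s))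
    untail : ∀ {r} → Representative d r → Similar (shift α (w a b s)) r → Similar (w a b s) r
    untail ((pr , _) , _) sim = shifts⇒similar (shifts-unshift (proj₁ (similar⇒shifts (shift-w-periodic s) pr sim)))

  periodicities : Σ ℕ (λ n → NumPeriodicities a b n × + n ≡ N (a + b))
  periodicities = length allReps ,
    numClasses-fromReps (λ _ _ → tt) allReps
      (concatMap-all⁺ orbitReps (All.tabulate (All.map (λ (rep , _) → rep , tt) ∘ proj₁ ∘ divisor-reps)))
      (concatMap-allPairs⁺ (divisors-unique (a + b)) (All.tabulate (proj₁ ∘ proj₂ ∘ divisor-reps))
         (All.tabulate (All.map proj₂ ∘ proj₁ ∘ divisor-reps))
         λ d≢d′ lpr lps sim → d≢d′ (similar-leastPeriod lpr lps sim))
      (λ s _ → w-similar-allReps s) ,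
    (begin
      + length allReps
        ≡⟨ cong +_ (length-concatMap orbitReps (divisors (a + b))) ⟩
      + sum (map (length ∘ orbitReps) (divisors (a + b)))
        ≡⟨ sumℤ-map≡+sum (All.tabulate (proj₂ ∘ proj₂ ∘ divisor-reps)) ⟨
      N (a + b) ∎)

corollary3p15 : (a b : ℕ) → 1 ≤ a → 1 ≤ b → a ≢ b → gcd a b ≡ 1 →
    ((ℓ : ℕ) → 1 ≤ ℓ → ℓ ∣ (a + b) →
      Σ ℕ (λ n → NumPeriodicitiesOfLength a b ℓ n × + n ≡ N' ℓ))
    × Σ ℕ (λ n → NumPeriodicities a b n × + n ≡ N (a + b))
corollary3p15 a b a≥1 b≥1 _ gcd≡1 = periodicitiesOfLength , periodicities
  where open Periodicities a b a≥1 b≥1 (gcd≡1⇒coprime gcd≡1)
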